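{- The set of binary delta-matroids in which the empty set is feasible is closed under handle slides: if $D=(E,\mathcal{F})$ is a binary delta-matroid with $\emptyset\in\mathcal{F}$ and $a,b\in E$ are distinct, then $D_{ab}$ is a binary delta-matroid in which the empty set is feasible.
   Context: A delta-matroid is a set system $(E,\mathcal{F})$ ($E$ finite, $\mathcal{F}$ a non-empty collection of subsets of $E$) such that for all $X,Y\in\mathcal{F}$ and $u\in X\triangle Y$ there is $v\in X\triangle Y$ with $X\triangle\{u,v\}\in\mathcal{F}$. For a symmetric matrix $M$ over $GF(2)$ indexed by $E$, $D(M)$ has as feasible sets the $A\subseteq E$ with $M[A]$ non-singular ($M[\emptyset]$ non-singular by convention). The twist $D*A=(E,\{A\triangle X:X\in\mathcal{F}\})$. $D$ is binary if some twist of $D$ is isomorphic to $D(M)$ for a symmetric matrix $M$ over $GF(2)$. The handle slide of $a$ over $b$ gives $D_{ab}=(E,\mathcal{F}\triangle\{X\cup\{a\}: X\cup\{b\}\in\mathcal{F},\ X\subseteq E\setminus\{a,b\}\})$. -}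

module Defs where

open import Data.Nat using (ℕ)
open import Data.Bool using (Bool; true; false; _xor_; _∧_; not)
open import Data.Fin using (Fin)
open import Data.Fin.Subset using (Subset; _∈_; _⊆_; ⁅_⁆; ⊥; _∪_)
open import Data.Fin.Permutation using (Permutation′; _⟨$⟩ˡ_)
open import Data.Vec using (Vec; zipWith; tabulate; lookup; foldr′; _[_]≔_)
open import Data.Product using (Σ; ∃; _×_; _,_)
open import Relation.Binary.PropositionalEquality using (_≡_)

-- A set system on the ground set E = Fin n: the collection F of feasible sets
-- is given by its characteristic function (X is feasible iff F X ≡ true).
SetSystem : ℕ → Set
SetSystem n = Subset n → Bool

Feasible : ∀ {n} → SetSystem n → Subset n → Set
Feasible F X = F X ≡ true

_△_ : ∀ {n} → Subset n → Subset n → Subset n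
_△_ = zipWith _xor_

infixl 6 _△_

-- (E,F) is a delta-matroid: F non-empty and the symmetric exchange axiom
-- (u and v may coincide, as in the paper's definition).
IsDeltaMatroid : ∀ {n} → SetSystem n → Set
IsDeltaMatroid {n} F =
  (∃ λ X → Feasible F X) ×
  (∀ X Y → Feasible F X → Feasible F Y →
     ∀ (u : Fin n) → u ∈ (X △ Y) →
       ∃ λ (v : Fin n) → v ∈ (X △ Y) × Feasible F (X △ (⁅ u ⁆ ∪ ⁅ v ⁆)))

-- Symmetric matrices over GF(2) = Bool (xor as +, ∧ as ·)
Matrix : ℕ → Set
Matrix n = Fin n → Fin n → Bool

Symmetric : ∀ {n} → Matrix n → Set
Symmetric M = ∀ i j → M i j ≡ M j i

Σ₂ : ∀ {n} → (Fin n → Bool) → Bool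
Σ₂ f = foldr′ _xor_ false (tabulate f)

-- The principal submatrix M[A] is non-singular over GF(2): its kernel is
-- trivial, i.e. the only vector x supported on A with (M x)_i = 0 for all
-- i ∈ A is x = 0.  (For A = ∅ this holds vacuously: M[∅] non-singular.)
NonSingularPrincipal : ∀ {n} → Matrix n → Subset n → Set
NonSingularPrincipal {n} M A =
  ∀ (x : Subset n) → x ⊆ A →
    (∀ i → i ∈ A → Σ₂ (λ j → M i j ∧ lookup x j) ≡ false) →
    x ≡ ⊥

FeasibleDM : ∀ {n} → Matrix n → Subset n → Set
FeasibleDM M A = NonSingularPrincipal M A

twist : ∀ {n} → SetSystem n → Subset n → SetSystem n
twist F A Z = F (A △ Z)

image : ∀ {n} → Permutation′ n → Subset n → Subset n
image σ X = tabulate (λ i → lookup X (σ ⟨$⟩ˡ i))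

IsBinary : ∀ {n} → SetSystem n → Set
IsBinary {n} F =
  Σ (Subset n) λ A → Σ (Matrix n) λ M → Σ (Permutation′ n) λ σ →
    Symmetric M ×
    (∀ X → (Feasible (twist F A) X → FeasibleDM M (image σ X)) ×
           (FeasibleDM M (image σ X) → Feasible (twist F A) X))

-- handle slide of a over b:
-- F_ab = F △ { X ∪ {a} : X ∪ {b} ∈ F, X ⊆ E \ {a,b} }.
-- Z = X ∪ {a} with X ⊆ E∖{a,b} iff a ∈ Z, b ∉ Z, and then
-- X ∪ {b} = Z with a removed and b added.
handleSlide : ∀ {n} → SetSystem n → Fin n → Fin n → SetSystem n
handleSlide F a b Z =
  F Z xor (lookup Z a ∧ not (lookup Z b) ∧ F ((Z [ a ]≔ false) [ b ]≔ true))

module Submission where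

-- We represent set systems as D(N) for symmetric matrices N over GF(2) (feasible sets are
-- the X with N[X] non-singular, i.e. with trivial kernel).  The principal pivot N * S,
-- characterised by exchanging the S-coordinates of x and N·x, satisfies
-- D(N * S) = D(N) * S, and exists whenever N[S] is non-singular: it is built by
-- iterating 1×1 and 2×2 elementary pivots.  From this we derive, in order:
--   * a binary F with ∅ feasible equals D(R) for a symmetric R (pivot the twist away);
--   * every D(R) is a delta-matroid (pivot on a feasible X and find a non-singular 1×1
--     or 2×2 principal submatrix of R * X at the given element);
--   * D(N)_{ab} = D(N_{ab}) for the congruent matrix N_{ab} = E N Eᵀ, E adding row b to
--     row a; for a ∈ W, b ∉ W this is the identity "N_{ab}[W] is non-singular iff exactly
--     one of N[W] and N[W △ {a,b}] is", proved by pivoting on W.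

open import Defs
open import Data.Nat using (ℕ; zero; suc; _+_; _≤_)
open import Data.Nat.Properties using (≤-refl; ≤-trans; ≤-pred; n≤1+n; +-suc)
open import Data.Bool using (Bool; true; false; _xor_; _∧_; _∨_; not; if_then_else_)
open import Data.Bool.Properties using (xor-∧-commutativeRing; xor-identityʳ; xor-assoc; xor-same; xor-comm)
import Data.Bool.Properties as Boolₚ
open import Data.Fin using (Fin; zero; suc)
open import Data.Fin.Subset using (Subset; ⊥; ⁅_⁆; _∪_; _∈_)
open import Data.Fin.Subset.Properties using (x∈⁅x⁆; x∈⁅y⁆⇒x≡y)
open import Data.Fin.Permutation using (Permutation′; _⟨$⟩ˡ_; _⟨$⟩ʳ_; inverseˡ; inverseʳ; flip)
  renaming (id to identityPermutation)
open import Data.Vec using (lookup; tabulate; _[_]≔_)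
open import Data.Vec.Properties
  using (lookup∘tabulate; tabulate∘lookup; tabulate-cong; lookup-replicate; lookup-zipWith;
         []=⇒lookup; lookup⇒[]=; lookup∘update; lookup∘update′)
open import Data.Fin.Properties using (_≟_; suc-injective; any?)
open import Algebra.Bundles using (CommutativeRing)
open import Data.Product using (Σ; ∃; _×_; _,_; proj₁; proj₂)
open import Data.Empty using (⊥-elim)
open import Relation.Nullary using (Dec; yes; no; does; ¬_; contradiction; _×-dec_)
open import Relation.Nullary.Decidable using (True; toWitness; dec-true; dec-false)
open import Relation.Binary.PropositionalEquality
open import Function.Bundles using (_⇔_; mk⇔; Equivalence)
open import Function.Base using (_∘_)
import Function.Properties.Equivalence as ⇔
open ≡-Reasoning

module GF₂ = CommutativeRing xor-∧-commutativeRing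
open import Algebra.Properties.Semiring.Sum GF₂.semiring
  using (sum; sum-cong-≗; ∑-distrib-+; *-distribˡ-sum; sum-permute; sum-replicate-zero)

-- Boolean functions of k arguments, curried, and their pointwise agreement; agreement
-- is decidable by evaluation, which proves identities in a few Boolean variables.
BoolFun : ℕ → Set
BoolFun zero = Bool
BoolFun (suc k) = Bool → BoolFun k

Agree : ∀ {k} → BoolFun k → BoolFun k → Set
Agree {zero} f g = f ≡ g
Agree {suc k} f g = ∀ b → Agree (f b) (g b)

agree? : ∀ {k} (f g : BoolFun k) → Dec (Agree f g)
agree? {zero} f g = f Boolₚ.≟ g
agree? {suc k} f g with agree? (f false) (g false) | agree? (f true) (g true)
... | yes p | yes q = yes λ { false → p ; true → q }
... | no ¬p | _ = no λ h → ¬p (h false)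
... | _ | no ¬q = no λ h → ¬q (h true)

boolean-identity : ∀ k {f g : BoolFun k} {checked : True (agree? f g)} → Agree f g
boolean-identity k {checked = checked} = toWitness checked

xor-cancelʳ : ∀ a b → (a xor b) xor b ≡ a
xor-cancelʳ = boolean-identity 2

xor-cancelˡ : ∀ a b → a xor (a xor b) ≡ b
xor-cancelˡ = boolean-identity 2

xor-≡-false : ∀ {p q : Bool} → p ≡ q → p xor q ≡ false
xor-≡-false {p} refl = xor-same p

≡-from-xor : ∀ {p q : Bool} → p xor q ≡ false → p ≡ q
≡-from-xor {false} {false} _ = refl
≡-from-xor {true} {true} _ = refl

-- Vectors over GF(2) indexed by the ground set Fin n; they also encode subsets.
Vector : ℕ → Set
Vector n = Fin n → Bool

IsZero : ∀ {n} → Vector n → Set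
IsZero x = ∀ i → x i ≡ false

Σ₂≡sum : ∀ {n} (f : Vector n) → Σ₂ f ≡ sum f
Σ₂≡sum {zero} f = refl
Σ₂≡sum {suc n} f = cong (f zero xor_) (Σ₂≡sum (λ j → f (suc j)))

sum-zero : ∀ {n} {f : Vector n} → IsZero f → sum f ≡ false
sum-zero {n} f≡0 = trans (sum-cong-≗ f≡0) (sum-replicate-zero n)

sum-xor : ∀ {n} (f g : Vector n) → sum (λ j → f j xor g j) ≡ sum f xor sum g
sum-xor = ∑-distrib-+

sum-scale : ∀ {n} (c : Bool) (f : Vector n) → sum (λ j → c ∧ f j) ≡ c ∧ sum f
sum-scale c f = sym (*-distribˡ-sum c f)


δ : ∀ {n} → Fin n → Fin n → Bool
δ i j = does (i ≟ j)

δ-refl : ∀ {n} (i : Fin n) → δ i i ≡ true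
δ-refl i = dec-true (i ≟ i) refl

δ-≢ : ∀ {n} {i j : Fin n} → i ≢ j → δ i j ≡ false
δ-≢ {i = i} {j} i≢j = dec-false (i ≟ j) i≢j

δ-true : ∀ {n} {i j : Fin n} → δ i j ≡ true → i ≡ j
δ-true {i = i} {j} h with i ≟ j
... | yes i≡j = i≡j

sum-point : ∀ {n} (s : Fin n) {f : Vector n} → (∀ j → j ≢ s → f j ≡ false) → sum f ≡ f s
sum-point {suc n} zero {f} off = begin
  f zero xor sum (λ j → f (suc j))  ≡⟨ cong (f zero xor_) (sum-zero (λ j → off (suc j) λ ())) ⟩
  f zero xor false                  ≡⟨ xor-identityʳ (f zero) ⟩
  f zero                            ∎
sum-point {suc n} (suc s) {f} off = begin
  f zero xor sum (λ j → f (suc j))  ≡⟨ cong (_xor sum (λ j → f (suc j))) (off zero λ ()) ⟩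
  sum (λ j → f (suc j))             ≡⟨ sum-point s (λ j j≢s → off (suc j) (λ e → j≢s (suc-injective e))) ⟩
  f (suc s)                         ∎

sum-δ : ∀ {n} (t : Fin n) (g : Vector n) → sum (λ j → δ j t ∧ g j) ≡ g t
sum-δ t g = trans (sum-point t (λ j j≢t → cong (_∧ g j) (δ-≢ j≢t))) (cong (_∧ g t) (δ-refl t))

sum-via-difference : ∀ {n} (f g : Vector n) → sum f ≡ sum (λ j → f j xor g j) xor sum g
sum-via-difference f g = begin
  sum f                                     ≡⟨ sum-cong-≗ (λ j → sym (xor-cancelʳ (f j) (g j))) ⟩
  sum (λ j → (f j xor g j) xor g j)         ≡⟨ sum-xor (λ j → f j xor g j) g ⟩
  sum (λ j → f j xor g j) xor sum g         ∎

sum-agree-off : ∀ {n} (s : Fin n) {f g : Vector n} → (∀ j → j ≢ s → f j ≡ g j) →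
  sum f ≡ (f s xor g s) xor sum g
sum-agree-off s {f} {g} agree = begin
  sum f                                ≡⟨ sum-via-difference f g ⟩
  sum (λ j → f j xor g j) xor sum g    ≡⟨ cong (_xor sum g) (sum-point s (λ j j≢s → xor-≡-false (agree j j≢s))) ⟩
  (f s xor g s) xor sum g              ∎

sum-two-points : ∀ {n} {s t : Fin n} {f : Vector n} → s ≢ t → (∀ j → j ≢ s → j ≢ t → f j ≡ false) →
  sum f ≡ f s xor f t
sum-two-points {s = s} {t} {f} s≢t off = begin
  sum f                                  ≡⟨ sum-agree-off s agree ⟩
  (f s xor (δ s t ∧ f s)) xor sum f′
    ≡⟨ cong₂ (λ d r → (f s xor (d ∧ f s)) xor r) (δ-≢ s≢t) (sum-point t off′) ⟩
  (f s xor false) xor (δ t t ∧ f t)      ≡⟨ cong (λ d → (f s xor false) xor (d ∧ f t)) (δ-refl t) ⟩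
  (f s xor false) xor (true ∧ f t)       ≡⟨ tidy (f s) (f t) ⟩
  f s xor f t                            ∎
  where
  f′ : Vector _
  f′ j = δ j t ∧ f j
  agree : ∀ j → j ≢ s → f j ≡ f′ j
  agree j j≢s with j ≟ t
  ... | yes _ = refl
  ... | no j≢t = off j j≢s j≢t
  off′ : ∀ j → j ≢ t → f′ j ≡ false
  off′ j j≢t = cong (_∧ f j) (δ-≢ j≢t)
  tidy : ∀ a b → (a xor false) xor (true ∧ b) ≡ a xor b
  tidy = boolean-identity 2

sum-agree-off₂ : ∀ {n} {s t : Fin n} {f g : Vector n} → s ≢ t → (∀ j → j ≢ s → j ≢ t → f j ≡ g j) →
  sum f ≡ ((f s xor g s) xor (f t xor g t)) xor sum g
sum-agree-off₂ {f = f} {g} s≢t agree =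
  trans (sum-via-difference f g)
        (cong (_xor sum g) (sum-two-points s≢t (λ j j≢s j≢t → xor-≡-false (agree j j≢s j≢t))))

_·_ : ∀ {n} → Matrix n → Vector n → Vector n
(M · x) i = sum (λ j → M i j ∧ x j)

infixr 7 _·_

_⊑_ : ∀ {n} → Vector n → Vector n → Set
x ⊑ A = ∀ i → x i ≡ true → A i ≡ true

⊑-outside : ∀ {n} {x W : Vector n} → x ⊑ W → ∀ {j} → W j ≡ false → x j ≡ false
⊑-outside x⊑W {j} Wj = Boolₚ.¬-not (λ xj → contradiction (trans (sym (x⊑W j xj)) Wj) λ ())

⊑-from-outside : ∀ {n} {x W : Vector n} → (∀ j → W j ≡ false → x j ≡ false) → x ⊑ W
⊑-from-outside {W = W} outside j xj =
  Boolₚ.¬-not {W j} {false} (λ Wj → contradiction (trans (sym xj) (outside j Wj)) λ ())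

separated : ∀ {n} {W : Vector n} {i j : Fin n} → W i ≡ true → W j ≡ false → i ≢ j
separated Wi Wj refl = contradiction (trans (sym Wi) Wj) λ ()

_⊕_ : ∀ {n} → Vector n → Vector n → Vector n
(A ⊕ B) i = A i xor B i

infixl 6 _⊕_

NonSingular : ∀ {n} → Matrix n → Vector n → Set
NonSingular M A = ∀ x → x ⊑ A → (∀ i → A i ≡ true → (M · x) i ≡ false) → IsZero x

·-cong : ∀ {n} (M : Matrix n) {x y : Vector n} → x ≗ y → M · x ≗ M · y
·-cong M x≗y i = sum-cong-≗ (λ j → cong (M i j ∧_) (x≗y j))

·-zero : ∀ {n} (M : Matrix n) {x : Vector n} → IsZero x → IsZero (M · x)
·-zero M {x} x≡0 i = sum-zero (λ j → trans (cong (M i j ∧_) (x≡0 j)) (Boolₚ.∧-zeroʳ (M i j)))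

nonsingular-cong : ∀ {n} {M : Matrix n} {A B : Vector n} → A ≗ B → NonSingular M A → NonSingular M B
nonsingular-cong A≗B ns x x⊑B kernel =
  ns x (λ i xi → trans (A≗B i) (x⊑B i xi)) (λ i Ai → kernel i (trans (sym (A≗B i)) Ai))

nonsingular-cong⇔ : ∀ {n} {M : Matrix n} {A B : Vector n} → A ≗ B → NonSingular M A ⇔ NonSingular M B
nonsingular-cong⇔ A≗B = mk⇔ (nonsingular-cong A≗B) (nonsingular-cong (λ i → sym (A≗B i)))

nonsingular-local : ∀ {n} {M M′ : Matrix n} {A : Vector n} →
  (∀ x → x ⊑ A → ∀ i → A i ≡ true → (M · x) i ≡ (M′ · x) i) → NonSingular M A → NonSingular M′ A
nonsingular-local same ns x x⊑A kernel = ns x x⊑A (λ i Ai → trans (same x x⊑A i Ai) (kernel i Ai))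

_≐_ : ∀ {n} → Matrix n → Matrix n → Set
M ≐ N = ∀ i j → M i j ≡ N i j

·-cong-matrix : ∀ {n} {M N : Matrix n} → M ≐ N → ∀ x → M · x ≗ N · x
·-cong-matrix M≐N x i = sum-cong-≗ (λ j → cong (_∧ x j) (M≐N i j))

select : ∀ {n} → Vector n → Vector n → Vector n → Vector n
select S y x j = if S j then y j else x j

-- N is a principal pivot transform of M on S: exchanging the S-coordinates of x and
-- M·x turns each pair (x , M·x) into a pair (x′ , N·x′).
IsPivot : ∀ {n} → Matrix n → Vector n → Matrix n → Set
IsPivot M S N = ∀ x → N · select S (M · x) x ≗ select S x (M · x)

private
  -- Coordinatewise facts behind pivot-transfer; at an index j we write s for "j ∈ S",
  -- X for "j ∈ X", x and y for the j-th coordinates of x and B·x.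
  support-step : ∀ s {x y X : Bool} → (x ≡ true → X ≡ true) → (X ≡ true → y ≡ false) →
    (if s then y else x) ≡ true → X xor s ≡ true
  support-step false {X = X} x→X _ h = trans (xor-identityʳ X) (x→X h)
  support-step true {X = false} _ _ _ = refl
  support-step true {X = true} _ X→y h = contradiction (trans (sym h) (X→y refl)) λ ()

  kernel-step : ∀ s {x y X : Bool} → (x ≡ true → X ≡ true) → (X ≡ true → y ≡ false) →
    X xor s ≡ true → (if s then x else y) ≡ false
  kernel-step false {X = X} _ X→y h = X→y (trans (sym (xor-identityʳ X)) h)
  kernel-step true {false} _ _ _ = refl
  kernel-step true {true} {X = false} x→X _ _ = contradiction (x→X refl) λ ()

  recover-step : ∀ s {x y a : Bool} → a ≡ (if s then x else y) → a ≡ false →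
    (if s then y else x) ≡ false → x ≡ false
  recover-step true e a≡0 _ = trans (sym e) a≡0
  recover-step false _ _ h = h

pivot-transfer : ∀ {n} {B A : Matrix n} {S X : Vector n} →
  IsPivot B S A → NonSingular A (X ⊕ S) → NonSingular B X
pivot-transfer {B = B} {A} {S} {X} piv ns x x⊑X kernel i =
  recover-step (S i) (piv x i) (·-zero A z≡0 i) (z≡0 i)
  where
  z = select S (B · x) x
  z≡0 : IsZero z
  z≡0 = ns z (λ j → support-step (S j) (x⊑X j) (kernel j))
             (λ j h → trans (piv x j) (kernel-step (S j) (x⊑X j) (kernel j) h))

pivot-compose : ∀ {n} {M M₁ M₂ : Matrix n} {S T : Vector n} →
  IsPivot M S M₁ → IsPivot M₁ T M₂ → IsPivot M (S ⊕ T) M₂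
pivot-compose {M = M} {M₁} {M₂} {S} {T} first second x i = begin
  (M₂ · select (S ⊕ T) y x) i        ≡⟨ ·-cong M₂ merge i ⟩
  (M₂ · select T (M₁ · x₁) x₁) i     ≡⟨ second x₁ i ⟩
  select T x₁ (M₁ · x₁) i            ≡⟨ cong (if T i then x₁ i else_) (first x i) ⟩
  (if T i then x₁ i else select S x y i)  ≡⟨ sym (select-xor (S i) (T i) (x i) (y i)) ⟩
  select (S ⊕ T) x y i               ∎
  where
  y = M · x
  x₁ = select S y x
  select-xor : ∀ s t u v → (if s xor t then u else v) ≡
    (if t then (if s then v else u) else (if s then u else v))
  select-xor = boolean-identity 4
  merge : select (S ⊕ T) y x ≗ select T (M₁ · x₁) x₁
  merge j = trans (select-xor (S j) (T j) (y j) (x j))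
                  (cong (λ u → if T j then u else x₁ j) (sym (first x j)))

pivot-empty : ∀ {n} (M : Matrix n) {S : Vector n} → IsZero S → IsPivot M S M
pivot-empty M {S} S≡0 x i = begin
  (M · select S (M · x) x) i   ≡⟨ ·-cong M (λ j → cong (if_then (M · x) j else x j) (S≡0 j)) i ⟩
  (M · x) i                    ≡⟨ cong (if_then x i else (M · x) i) (sym (S≡0 i)) ⟩
  select S x (M · x) i         ∎

pivot-cong-set : ∀ {n} {M N : Matrix n} {S T : Vector n} → S ≗ T → IsPivot M S N → IsPivot M T N
pivot-cong-set {M = M} {N} {S} {T} S≗T piv x i = begin
  (N · select T (M · x) x) i   ≡⟨ ·-cong N (λ j → cong (if_then (M · x) j else x j) (sym (S≗T j))) i ⟩
  (N · select S (M · x) x) i   ≡⟨ piv x i ⟩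
  select S x (M · x) i         ≡⟨ cong (if_then x i else (M · x) i) (S≗T i) ⟩
  select T x (M · x) i         ∎

pivot-cong-result : ∀ {n} {M N N′ : Matrix n} {S : Vector n} → N ≐ N′ → IsPivot M S N → IsPivot M S N′
pivot-cong-result {M = M} {N} {N′} {S} N≐N′ piv x i =
  trans (sym (·-cong-matrix N≐N′ (select S (M · x) x) i)) (piv x i)

-- A symmetric matrix R together with pivots M ⇄ R on S: R is "M * S".
record PivotPair {n} (M : Matrix n) (S : Vector n) : Set where
  field
    pivoted : Matrix n
    pivoted-symmetric : Symmetric pivoted
    forward : IsPivot M S pivoted
    backward : IsPivot pivoted S M

open PivotPair public

pivot-twist : ∀ {n} {M : Matrix n} {S : Vector n} (P : PivotPair M S) {X : Vector n} →
  NonSingular M (S ⊕ X) ⇔ NonSingular (pivoted P) X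
pivot-twist {S = S} P {X} = mk⇔
  (λ ns → pivot-transfer (backward P) (nonsingular-cong (λ i → xor-comm (S i) (X i)) ns))
  (λ ns → pivot-transfer (forward P) (nonsingular-cong (λ i → sym (cancel (S i) (X i))) ns))
  where
  cancel : ∀ a b → (a xor b) xor a ≡ b
  cancel = boolean-identity 2

pivotPair-compose : ∀ {n} {M : Matrix n} {S T : Vector n} →
  (P : PivotPair M T) → PivotPair (pivoted P) (S ⊕ T) → PivotPair M S
pivotPair-compose {S = S} {T} P Q = record
  { pivoted = pivoted Q
  ; pivoted-symmetric = pivoted-symmetric Q
  ; forward = pivot-cong-set (λ i → cancelˡ (T i) (S i)) (pivot-compose (forward P) (forward Q))
  ; backward = pivot-cong-set (λ i → xor-cancelʳ (S i) (T i)) (pivot-compose (backward Q) (backward P))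
  }
  where
  cancelˡ : ∀ a b → a xor (b xor a) ≡ b
  cancelˡ = boolean-identity 2

single : ∀ {n} → Fin n → Vector n
single s j = δ j s

-- Elementary pivot on a diagonal entry M s s = 1: the Schur complement formula over GF(2).
pivot₁ : ∀ {n} → Matrix n → Fin n → Matrix n
pivot₁ M s i j = M i j xor ((not (δ i s) ∧ not (δ j s)) ∧ (M i s ∧ M s j))

pivot₁-column : ∀ {n} (M : Matrix n) (s i : Fin n) → pivot₁ M s i s ≡ M i s
pivot₁-column M s i rewrite δ-refl s = unchanged (M i s) (not (δ i s)) (M s s)
  where
  unchanged : ∀ a b c → a xor ((b ∧ not true) ∧ (a ∧ c)) ≡ a
  unchanged = boolean-identity 3

pivot₁-row : ∀ {n} (M : Matrix n) (s j : Fin n) → pivot₁ M s s j ≡ M s j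
pivot₁-row M s j rewrite δ-refl s = unchanged (M s j) (not (δ j s)) (M s s)
  where
  unchanged : ∀ a b c → a xor ((not true ∧ b) ∧ (c ∧ a)) ≡ a
  unchanged = boolean-identity 3

pivot₁-involutive : ∀ {n} (M : Matrix n) (s : Fin n) → pivot₁ (pivot₁ M s) s ≐ M
pivot₁-involutive M s i j = begin
  pivot₁ N s i j
    ≡⟨ cong₂ (λ u v → N i j xor (ν ∧ (u ∧ v))) (pivot₁-column M s i) (pivot₁-row M s j) ⟩
  (M i j xor (ν ∧ c)) xor (ν ∧ c)      ≡⟨ xor-cancelʳ (M i j) (ν ∧ c) ⟩
  M i j                                ∎
  where
  N = pivot₁ M s
  ν = not (δ i s) ∧ not (δ j s)
  c = M i s ∧ M s j

pivot₁-symmetric : ∀ {n} {M : Matrix n} (s : Fin n) → Symmetric M → Symmetric (pivot₁ M s)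
pivot₁-symmetric {M = M} s sym-M i j =
  cong₂ _xor_ (sym-M i j) (cong₂ _∧_ (Boolₚ.∧-comm (not (δ i s)) (not (δ j s)))
    (trans (Boolₚ.∧-comm (M i s) (M s j)) (cong₂ _∧_ (sym-M s j) (sym-M i s))))

pivot₁-action : ∀ {n} (M : Matrix n) (s : Fin n) (x : Vector n) (i : Fin n) →
  let y = M · x ; c = not (δ i s) ∧ M i s in
  (pivot₁ M s · select (single s) y x) i ≡
    ((M i s ∧ y s) xor ((M i s ∧ x s) xor (c ∧ (M s s ∧ x s)))) xor (y i xor (c ∧ y s))
pivot₁-action M s x i = begin
  (N · z) i                                  ≡⟨ sum-agree-off s off-s ⟩
  ((N i s ∧ z s) xor g s) xor sum g          ≡⟨ cong₂ (λ u v → ((u ∧ v) xor g s) xor sum g) (pivot₁-column M s i) z-at-s ⟩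
  ((M i s ∧ y s) xor g s) xor sum g          ≡⟨ cong (((M i s ∧ y s) xor g s) xor_) sum-g ⟩
  ((M i s ∧ y s) xor g s) xor (y i xor (c ∧ y s))  ∎
  where
  N = pivot₁ M s
  y = M · x
  z = select (single s) y x
  c = not (δ i s) ∧ M i s
  g : Vector _
  g j = (M i j ∧ x j) xor (c ∧ (M s j ∧ x j))
  expand : ∀ a ν b d x → (a xor ((ν ∧ not false) ∧ (b ∧ d))) ∧ x ≡ (a ∧ x) xor ((ν ∧ b) ∧ (d ∧ x))
  expand = boolean-identity 5
  off-s : ∀ j → j ≢ s → (N i j ∧ z j) ≡ g j
  off-s j j≢s rewrite δ-≢ j≢s = expand (M i j) (not (δ i s)) (M i s) (M s j) (x j)
  z-at-s : z s ≡ y s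
  z-at-s rewrite δ-refl s = refl
  sum-g : sum g ≡ y i xor (c ∧ y s)
  sum-g = trans (sum-xor (λ j → M i j ∧ x j) (λ j → c ∧ (M s j ∧ x j)))
                (cong (y i xor_) (sum-scale c (λ j → M s j ∧ x j)))

private
  pivot₁-finish : ∀ {n} (M : Matrix n) (s i : Fin n) (x : Vector n) → M s s ≡ true →
    let y = M · x ; c = not (δ i s) ∧ M i s in
    ((M i s ∧ y s) xor ((M i s ∧ x s) xor (c ∧ (M s s ∧ x s)))) xor (y i xor (c ∧ y s)) ≡
      select (single s) x y i
  pivot₁-finish M s i x Mss with i ≟ s
  ... | yes refl rewrite Mss = at-pivot ((M · x) s) (x s)
    where
    at-pivot : ∀ y x → ((true ∧ y) xor ((true ∧ x) xor ((false ∧ true) ∧ (true ∧ x)))) xor (y xor ((false ∧ true) ∧ y)) ≡ x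
    at-pivot = boolean-identity 2
  ... | no _ rewrite Mss = elsewhere (M i s) ((M · x) s) (x s) ((M · x) i)
    where
    elsewhere : ∀ a y x yi → ((a ∧ y) xor ((a ∧ x) xor ((true ∧ a) ∧ (true ∧ x)))) xor (yi xor ((true ∧ a) ∧ y)) ≡ yi
    elsewhere = boolean-identity 4

pivot₁-forward : ∀ {n} {M : Matrix n} {s : Fin n} → M s s ≡ true → IsPivot M (single s) (pivot₁ M s)
pivot₁-forward {M = M} {s} Mss x i = trans (pivot₁-action M s x i) (pivot₁-finish M s i x Mss)

pivotPair₁ : ∀ {n} {M : Matrix n} {s : Fin n} → Symmetric M → M s s ≡ true → PivotPair M (single s)
pivotPair₁ {M = M} {s} sym-M Mss = record
  { pivoted = pivot₁ M s
  ; pivoted-symmetric = pivot₁-symmetric s sym-M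
  ; forward = pivot₁-forward Mss
  ; backward = pivot-cong-result (pivot₁-involutive M s) (pivot₁-forward (trans (pivot₁-column M s s) Mss))
  }

swap₂ : ∀ {n} → Fin n → Fin n → Fin n → Fin n
swap₂ s t i = if δ i s then t else (if δ i t then s else i)

outside : ∀ {n} → Fin n → Fin n → Fin n → Bool
outside s t i = not (δ i s) ∧ not (δ i t)

-- Elementary pivot on a block [[0,1],[1,0]] at rows and columns s, t.
pivot₂ : ∀ {n} → Matrix n → Fin n → Fin n → Matrix n
pivot₂ M s t i j =
  M (swap₂ s t i) (swap₂ s t j) xor
  ((outside s t i ∧ outside s t j) ∧ ((M i s ∧ M t j) xor (M i t ∧ M s j)))

module _ {n} {s t : Fin n} (s≢t : s ≢ t) where

  swap₂-s : swap₂ s t s ≡ t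
  swap₂-s rewrite δ-refl s = refl

  swap₂-t : swap₂ s t t ≡ s
  swap₂-t rewrite δ-≢ (λ t≡s → s≢t (sym t≡s)) | δ-refl t = refl

  outside-s : outside s t s ≡ false
  outside-s rewrite δ-refl s = refl

  outside-t : outside s t t ≡ false
  outside-t rewrite δ-refl t = Boolₚ.∧-zeroʳ _

  swap₂-elsewhere : ∀ {i} → i ≢ s → i ≢ t → swap₂ s t i ≡ i
  swap₂-elsewhere i≢s i≢t rewrite δ-≢ i≢s | δ-≢ i≢t = refl

  outside-elsewhere : ∀ {i} → i ≢ s → i ≢ t → outside s t i ≡ true
  outside-elsewhere i≢s i≢t rewrite δ-≢ i≢s | δ-≢ i≢t = refl

  data Position (i : Fin n) : Set where
    at-s : i ≡ s → Position i
    at-t : i ≡ t → Position i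
    elsewhere : i ≢ s → i ≢ t → Position i

  position : ∀ i → Position i
  position i with i ≟ s | i ≟ t
  ... | yes i≡s | _ = at-s i≡s
  ... | no _ | yes i≡t = at-t i≡t
  ... | no i≢s | no i≢t = elsewhere i≢s i≢t

  swap₂-involutive : ∀ i → swap₂ s t (swap₂ s t i) ≡ i
  swap₂-involutive i with position i
  ... | at-s refl = trans (cong (swap₂ s t) swap₂-s) swap₂-t
  ... | at-t refl = trans (cong (swap₂ s t) swap₂-t) swap₂-s
  ... | elsewhere i≢s i≢t = trans (cong (swap₂ s t) (swap₂-elsewhere i≢s i≢t)) (swap₂-elsewhere i≢s i≢t)

  outside-swap₂ : ∀ i → outside s t (swap₂ s t i) ≡ outside s t i
  outside-swap₂ i with position i
  ... | at-s refl = trans (cong (outside s t) swap₂-s) (trans outside-t (sym outside-s))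
  ... | at-t refl = trans (cong (outside s t) swap₂-t) (trans outside-s (sym outside-t))
  ... | elsewhere i≢s i≢t = cong (outside s t) (swap₂-elsewhere i≢s i≢t)

  private
    π = swap₂ s t
    ν = outside s t

    unchanged-right : ∀ a b c → a xor ((b ∧ false) ∧ c) ≡ a
    unchanged-right = boolean-identity 3

    unchanged-left : ∀ a b c → a xor ((false ∧ b) ∧ c) ≡ a
    unchanged-left = boolean-identity 3

  pivot₂-column-s : ∀ (M : Matrix n) i → pivot₂ M s t i s ≡ M (π i) t
  pivot₂-column-s M i rewrite swap₂-s | outside-s = unchanged-right (M (π i) t) (ν i) ((M i s ∧ M t s) xor (M i t ∧ M s s))

  pivot₂-column-t : ∀ (M : Matrix n) i → pivot₂ M s t i t ≡ M (π i) s
  pivot₂-column-t M i rewrite swap₂-t | outside-t = unchanged-right (M (π i) s) (ν i) ((M i s ∧ M t t) xor (M i t ∧ M s t))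

  pivot₂-row-s : ∀ (M : Matrix n) j → pivot₂ M s t s j ≡ M t (π j)
  pivot₂-row-s M j rewrite swap₂-s | outside-s = unchanged-left (M t (π j)) (ν j) ((M s s ∧ M t j) xor (M s t ∧ M s j))

  pivot₂-row-t : ∀ (M : Matrix n) j → pivot₂ M s t t j ≡ M s (π j)
  pivot₂-row-t M j rewrite swap₂-t | outside-t = unchanged-left (M s (π j)) (ν j) ((M t s ∧ M t j) xor (M t t ∧ M s j))

  pivot₂-involutive : ∀ (M : Matrix n) → pivot₂ (pivot₂ M s t) s t ≐ M
  pivot₂-involutive M i j = begin
    pivot₂ N s t i j
      ≡⟨ cong₂ _xor_ swapped-entry (cong ((ν i ∧ ν j) ∧_) (cong₂ _xor_
           (cong₂ _∧_ (pivot₂-column-s M i) (pivot₂-row-t M j))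
           (cong₂ _∧_ (pivot₂-column-t M i) (pivot₂-row-s M j)))) ⟩
    (M i j xor ((ν i ∧ ν j) ∧ (p xor q))) xor ((ν i ∧ ν j) ∧ (q xor p))
      ≡⟨ cancel (M i j) (ν i ∧ ν j) p q ⟩
    M i j ∎
    where
    N = pivot₂ M s t
    p = M (π i) s ∧ M t (π j)
    q = M (π i) t ∧ M s (π j)
    swapped-entry : N (π i) (π j) ≡ M i j xor ((ν i ∧ ν j) ∧ (p xor q))
    swapped-entry = cong₂ _xor_ (cong₂ M (swap₂-involutive i) (swap₂-involutive j))
                                (cong₂ (λ u v → (u ∧ v) ∧ (p xor q)) (outside-swap₂ i) (outside-swap₂ j))
    cancel : ∀ a c p q → (a xor (c ∧ (p xor q))) xor (c ∧ (q xor p)) ≡ a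
    cancel = boolean-identity 4

  pivot₂-symmetric : ∀ {M : Matrix n} → Symmetric M → Symmetric (pivot₂ M s t)
  pivot₂-symmetric {M} sym-M i j = cong₂ _xor_ (sym-M (π i) (π j))
    (trans (cong₂ (λ u v → (ν i ∧ ν j) ∧ ((u ∧ v) xor (M i t ∧ M s j))) (sym-M i s) (sym-M t j))
    (trans (cong₂ (λ u v → (ν i ∧ ν j) ∧ ((M s i ∧ M j t) xor (u ∧ v))) (sym-M i t) (sym-M s j))
           (transpose (ν i) (ν j) (M s i) (M j t) (M t i) (M j s))))
    where
    transpose : ∀ a b c d e f → (a ∧ b) ∧ ((c ∧ d) xor (e ∧ f)) ≡ (b ∧ a) ∧ ((f ∧ e) xor (d ∧ c))
    transpose = boolean-identity 6

  -- The closed form of (pivot₂ M s t · x′) i computed below, in terms of p = M (π i) s,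
  -- q = M (π i) t, the Schur coefficients a, b, the entries ys, yt, yπ of y = M·x at s, t,
  -- π i, the entries xs, xt of x, and the block entries mts = M t s, …, mst = M s t.
  pivot₂-form : (p q a b ys yt yπ xs xt mts mss mtt mst : Bool) → Bool
  pivot₂-form p q a b ys yt yπ xs xt mts mss mtt mst =
    (((q ∧ ys) xor ((p ∧ xs) xor ((a ∧ (mts ∧ xs)) xor (b ∧ (mss ∧ xs))))) xor
     ((p ∧ yt) xor ((q ∧ xt) xor ((a ∧ (mtt ∧ xt)) xor (b ∧ (mst ∧ xt)))))) xor
    (yπ xor ((a ∧ yt) xor (b ∧ ys)))

  pair-s : (single s ⊕ single t) s ≡ true
  pair-s rewrite δ-refl s | δ-≢ s≢t = refl

  pair-t : (single s ⊕ single t) t ≡ true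
  pair-t rewrite δ-refl t | δ-≢ (λ t≡s → s≢t (sym t≡s)) = refl

  pair-elsewhere : ∀ {j} → j ≢ s → j ≢ t → (single s ⊕ single t) j ≡ false
  pair-elsewhere j≢s j≢t rewrite δ-≢ j≢s | δ-≢ j≢t = refl

  pivot₂-action : ∀ (M : Matrix n) (x : Vector n) (i : Fin n) →
    let y = M · x ; a = ν i ∧ M i s ; b = ν i ∧ M i t in
    (pivot₂ M s t · select (single s ⊕ single t) y x) i ≡
      pivot₂-form (M (π i) s) (M (π i) t) a b (y s) (y t) (y (π i)) (x s) (x t) (M t s) (M s s) (M t t) (M s t)
  pivot₂-action M x i = begin
    (N · z) i
      ≡⟨ sum-agree-off₂ s≢t off-pair ⟩
    (((N i s ∧ z s) xor g s) xor ((N i t ∧ z t) xor g t)) xor sum g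
      ≡⟨ cong₂ (λ u v → ((u xor g s) xor (v xor g t)) xor sum g)
           (cong₂ _∧_ (pivot₂-column-s M i) (z-at pair-s)) (cong₂ _∧_ (pivot₂-column-t M i) (z-at pair-t)) ⟩
    (((M (π i) t ∧ y s) xor g s) xor ((M (π i) s ∧ y t) xor g t)) xor sum g
      ≡⟨ cong ((((M (π i) t ∧ y s) xor g s) xor ((M (π i) s ∧ y t) xor g t)) xor_) sum-g ⟩
    (((M (π i) t ∧ y s) xor g s) xor ((M (π i) s ∧ y t) xor g t)) xor (y (π i) xor ((a ∧ y t) xor (b ∧ y s)))
      ∎
    where
    N = pivot₂ M s t
    y = M · x
    z = select (single s ⊕ single t) y x
    a = ν i ∧ M i s
    b = ν i ∧ M i t
    g : Vector n
    g j = (M (π i) j ∧ x j) xor ((a ∧ (M t j ∧ x j)) xor (b ∧ (M s j ∧ x j)))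
    z-at : ∀ {j} → (single s ⊕ single t) j ≡ true → z j ≡ y j
    z-at P-j = cong (if_then y _ else x _) P-j
    expand : ∀ m ν p q r u x → (m xor ((ν ∧ true) ∧ ((p ∧ q) xor (r ∧ u)))) ∧ x ≡
                               (m ∧ x) xor (((ν ∧ p) ∧ (q ∧ x)) xor ((ν ∧ r) ∧ (u ∧ x)))
    expand = boolean-identity 7
    off-pair : ∀ j → j ≢ s → j ≢ t → (N i j ∧ z j) ≡ g j
    off-pair j j≢s j≢t
      rewrite swap₂-elsewhere j≢s j≢t | outside-elsewhere j≢s j≢t | pair-elsewhere j≢s j≢t
      = expand (M (π i) j) (ν i) (M i s) (M t j) (M i t) (M s j) (x j)
    sum-g : sum g ≡ y (π i) xor ((a ∧ y t) xor (b ∧ y s))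
    sum-g = begin
      sum g
        ≡⟨ sum-xor (λ j → M (π i) j ∧ x j) (λ j → (a ∧ (M t j ∧ x j)) xor (b ∧ (M s j ∧ x j))) ⟩
      y (π i) xor sum (λ j → (a ∧ (M t j ∧ x j)) xor (b ∧ (M s j ∧ x j)))
        ≡⟨ cong (y (π i) xor_) (sum-xor (λ j → a ∧ (M t j ∧ x j)) (λ j → b ∧ (M s j ∧ x j))) ⟩
      y (π i) xor (sum (λ j → a ∧ (M t j ∧ x j)) xor sum (λ j → b ∧ (M s j ∧ x j)))
        ≡⟨ cong (y (π i) xor_) (cong₂ _xor_ (sum-scale a (λ j → M t j ∧ x j)) (sum-scale b (λ j → M s j ∧ x j))) ⟩
      y (π i) xor ((a ∧ y t) xor (b ∧ y s))
        ∎

  private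
    Block : (mts mss mtt mst : Bool) → Set
    Block mts mss mtt mst = (mts ≡ true) × (mss ≡ false) × (mtt ≡ false) × (mst ≡ true)

    form-at-s : ∀ {p q a b yπ mts mss mtt mst} ys yt xs xt → Block mts mss mtt mst →
      p ≡ true → q ≡ false → a ≡ false → b ≡ false → yπ ≡ yt →
      pivot₂-form p q a b ys yt yπ xs xt mts mss mtt mst ≡ xs
    form-at-s ys yt xs xt (refl , refl , refl , refl) refl refl refl refl refl = value ys yt xs xt
      where
      value : ∀ ys yt xs xt → pivot₂-form true false false false ys yt yt xs xt true false false true ≡ xs
      value = boolean-identity 4

    form-at-t : ∀ {p q a b yπ mts mss mtt mst} ys yt xs xt → Block mts mss mtt mst →
      p ≡ false → q ≡ true → a ≡ false → b ≡ false → yπ ≡ ys →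
      pivot₂-form p q a b ys yt yπ xs xt mts mss mtt mst ≡ xt
    form-at-t ys yt xs xt (refl , refl , refl , refl) refl refl refl refl refl = value ys yt xs xt
      where
      value : ∀ ys yt xs xt → pivot₂-form false true false false ys yt ys xs xt true false false true ≡ xt
      value = boolean-identity 4

    form-elsewhere : ∀ {a b yπ mts mss mtt mst} p q ys yt yi xs xt → Block mts mss mtt mst →
      a ≡ p → b ≡ q → yπ ≡ yi →
      pivot₂-form p q a b ys yt yπ xs xt mts mss mtt mst ≡ yi
    form-elsewhere p q ys yt yi xs xt (refl , refl , refl , refl) refl refl refl = value p q ys yt yi xs xt
      where
      value : ∀ p q ys yt yi xs xt → pivot₂-form p q p q ys yt yi xs xt true false false true ≡ yi
      value = boolean-identity 7

    pivot₂-finish : ∀ (M : Matrix n) (x : Vector n) (i : Fin n) →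
      M s s ≡ false → M t t ≡ false → M s t ≡ true → M t s ≡ true →
      let y = M · x in
      pivot₂-form (M (π i) s) (M (π i) t) (ν i ∧ M i s) (ν i ∧ M i t) (y s) (y t) (y (π i)) (x s) (x t)
                  (M t s) (M s s) (M t t) (M s t)
        ≡ select (single s ⊕ single t) x y i
    pivot₂-finish M x i Mss Mtt Mst Mts with position i
    ... | at-s refl = trans
      (form-at-s (y s) (y t) (x s) (x t) (Mts , Mss , Mtt , Mst)
        (trans (cong (λ k → M k s) swap₂-s) Mts) (trans (cong (λ k → M k t) swap₂-s) Mtt)
        (cong (_∧ M s s) outside-s) (cong (_∧ M s t) outside-s) (cong y swap₂-s))
      (sym (cong (if_then x s else y s) pair-s))
      where y = M · x
    ... | at-t refl = trans
      (form-at-t (y s) (y t) (x s) (x t) (Mts , Mss , Mtt , Mst)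
        (trans (cong (λ k → M k s) swap₂-t) Mss) (trans (cong (λ k → M k t) swap₂-t) Mst)
        (cong (_∧ M t s) outside-t) (cong (_∧ M t t) outside-t) (cong y swap₂-t))
      (sym (cong (if_then x t else y t) pair-t))
      where y = M · x
    ... | elsewhere i≢s i≢t = trans
      (form-elsewhere (M (π i) s) (M (π i) t) (y s) (y t) (y i) (x s) (x t) (Mts , Mss , Mtt , Mst)
        (trans (cong (_∧ M i s) (outside-elsewhere i≢s i≢t)) (cong (λ k → M k s) (sym π-i)))
        (trans (cong (_∧ M i t) (outside-elsewhere i≢s i≢t)) (cong (λ k → M k t) (sym π-i)))
        (cong y π-i))
      (sym (cong (if_then x i else y i) (pair-elsewhere i≢s i≢t)))
      where
      y = M · x
      π-i = swap₂-elsewhere i≢s i≢t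

  pivot₂-forward : ∀ {M : Matrix n} → M s s ≡ false → M t t ≡ false → M s t ≡ true → M t s ≡ true →
    IsPivot M (single s ⊕ single t) (pivot₂ M s t)
  pivot₂-forward {M} Mss Mtt Mst Mts x i = trans (pivot₂-action M x i) (pivot₂-finish M x i Mss Mtt Mst Mts)

  pivotPair₂ : ∀ {M : Matrix n} → Symmetric M → M s s ≡ false → M t t ≡ false → M s t ≡ true →
    PivotPair M (single s ⊕ single t)
  pivotPair₂ {M} sym-M Mss Mtt Mst = record
    { pivoted = pivot₂ M s t
    ; pivoted-symmetric = pivot₂-symmetric sym-M
    ; forward = pivot₂-forward Mss Mtt Mst Mts
    ; backward = pivot-cong-result (pivot₂-involutive M)
        (pivot₂-forward (trans (pivot₂-column-s M s) (trans (cong (λ k → M k t) swap₂-s) Mtt))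
                        (trans (pivot₂-column-t M t) (trans (cong (λ k → M k s) swap₂-t) Mss))
                        (trans (pivot₂-column-t M s) (trans (cong (λ k → M k s) swap₂-s) Mts))
                        (trans (pivot₂-column-s M t) (trans (cong (λ k → M k t) swap₂-t) Mst)))
    }
    where
    Mts : M t s ≡ true
    Mts = trans (sym-M t s) Mst

-- The number of elements of a subset; pivoting removes elements, so it bounds the recursion.
size : ∀ {n} → Vector n → ℕ
size {zero} S = 0
size {suc n} S = (if S zero then 1 else 0) + size (λ j → S (suc j))

size-cong : ∀ {n} {S T : Vector n} → S ≗ T → size S ≡ size T
size-cong {zero} S≗T = refl
size-cong {suc n} S≗T = cong₂ (λ b r → (if b then 1 else 0) + r) (S≗T zero) (size-cong (λ j → S≗T (suc j)))

size-remove : ∀ {n} (S : Vector n) {s : Fin n} → S s ≡ true → suc (size (S ⊕ single s)) ≡ size S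
size-remove {suc n} S {zero} Ss rewrite Ss =
  cong suc (size-cong (λ j → xor-identityʳ (S (suc j))))
size-remove {suc n} S {suc s} Ss = begin
  suc (head′ + size (λ j → S (suc j) xor δ j s))   ≡⟨ sym (+-suc head′ _) ⟩
  head′ + suc (size (λ j → S (suc j) xor δ j s))   ≡⟨ cong₂ (λ b r → (if b then 1 else 0) + r) (xor-identityʳ (S zero))
                                                            (size-remove (λ j → S (suc j)) Ss) ⟩
  size S                                             ∎
  where
  head′ = if S zero xor false then 1 else 0

·-single : ∀ {n} (M : Matrix n) (s i : Fin n) → (M · single s) i ≡ M i s
·-single M s i = begin
  (M · single s) i    ≡⟨ sum-point s (λ j j≢s → trans (cong (M i j ∧_) (δ-≢ j≢s)) (Boolₚ.∧-zeroʳ (M i j))) ⟩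
  M i s ∧ δ s s       ≡⟨ cong (M i s ∧_) (δ-refl s) ⟩
  M i s ∧ true        ≡⟨ Boolₚ.∧-identityʳ (M i s) ⟩
  M i s               ∎

single⊑ : ∀ {n} {S : Vector n} {s : Fin n} → S s ≡ true → single s ⊑ S
single⊑ {S = S} Ss j δjs = subst (λ k → S k ≡ true) (sym (δ-true δjs)) Ss

-- A non-singular symmetric M[S] has, in every row s ∈ S, a nonzero entry inside S:
-- otherwise the unit vector at s would lie in the kernel.
row-nonzero : ∀ {n} {M : Matrix n} {S : Vector n} {s : Fin n} → Symmetric M → NonSingular M S →
  S s ≡ true → ∃ λ t → S t ≡ true × M s t ≡ true
row-nonzero {M = M} {S} {s} sym-M ns Ss
  with any? (λ t → (S t Boolₚ.≟ true) ×-dec (M s t Boolₚ.≟ true))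
... | yes found = found
... | no none = contradiction (trans (sym (δ-refl s)) (ns (single s) (single⊑ Ss) unit-in-kernel s)) λ ()
  where
  unit-in-kernel : ∀ i → S i ≡ true → (M · single s) i ≡ false
  unit-in-kernel i Si = trans (·-single M s i) (trans (sym-M i s) (Boolₚ.¬-not (λ Msi → none (i , Si , Msi))))

pivotPair-empty : ∀ {n} {M : Matrix n} {S : Vector n} → Symmetric M → IsZero S → PivotPair M S
pivotPair-empty {M = M} sym-M S≡0 = record
  { pivoted = M ; pivoted-symmetric = sym-M ; forward = pivot-empty M S≡0 ; backward = pivot-empty M S≡0 }

pivot-remaining : ∀ {n} {M : Matrix n} {S T : Vector n} (P : PivotPair M T) →
  NonSingular M S → NonSingular (pivoted P) (S ⊕ T)
pivot-remaining {S = S} {T} P ns = Equivalence.to (pivot-twist P) (nonsingular-cong (λ i → restore (S i) (T i)) ns)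
  where
  restore : ∀ a b → a ≡ b xor (a xor b)
  restore = boolean-identity 2

private
  pivot-step : ∀ {n} {M : Matrix n} {S T : Vector n} k → (P : PivotPair M T) → NonSingular M S →
    (∀ {M′ S′} → size S′ ≤ k → Symmetric M′ → NonSingular M′ S′ → PivotPair M′ S′) →
    size (S ⊕ T) ≤ k → PivotPair M S
  pivot-step k P ns recurse bound =
    pivotPair-compose P (recurse bound (pivoted-symmetric P) (pivot-remaining P ns))

  size-after-single : ∀ {n} {S : Vector n} {s : Fin n} {k} → S s ≡ true → size S ≤ suc k →
    size (S ⊕ single s) ≤ k
  size-after-single {S = S} Ss bound = ≤-pred (subst (_≤ _) (sym (size-remove S Ss)) bound)

  size-after-pair : ∀ {n} {S : Vector n} {s t : Fin n} {k} → s ≢ t → S s ≡ true → S t ≡ true →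
    size S ≤ suc k → size (S ⊕ (single s ⊕ single t)) ≤ k
  size-after-pair {S = S} {s} {t} s≢t Ss St bound =
    subst (_≤ _) (size-cong (λ i → xor-assoc (S i) (δ i s) (δ i t)))
      (size-after-single {S = S ⊕ single s} t-remains (≤-trans (size-after-single {S = S} Ss bound) (n≤1+n _)))
    where
    t-remains : S t xor δ t s ≡ true
    t-remains = trans (cong (S t xor_) (δ-≢ (λ t≡s → s≢t (sym t≡s)))) (trans (xor-identityʳ (S t)) St)

-- Every symmetric M with M[S] non-singular has a symmetric pivot M * S.  By induction on
-- |S|: pivot on a nonzero diagonal entry of S, or else on a block [[0,1],[1,0]] in S.
pivotPair-within : ∀ k {n} {M : Matrix n} {S : Vector n} → size S ≤ k →
  Symmetric M → NonSingular M S → PivotPair M S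
pivotPair-within k {M = M} {S} bound sym-M ns with any? (λ s → S s Boolₚ.≟ true)
... | no empty = pivotPair-empty sym-M (λ s → Boolₚ.¬-not (λ Ss → empty (s , Ss)))
... | yes (s , Ss) with k
...   | zero = contradiction (subst (_≤ 0) (sym (size-remove S Ss)) bound) λ ()
...   | suc k′ with M s s Boolₚ.≟ true | row-nonzero sym-M ns Ss
...     | yes Mss | _ =
  pivot-step k′ (pivotPair₁ sym-M Mss) ns (pivotPair-within k′) (size-after-single {S = S} Ss bound)
...     | no Mss≢1 | t , St , Mst with M t t Boolₚ.≟ true
...       | yes Mtt =
  pivot-step k′ (pivotPair₁ sym-M Mtt) ns (pivotPair-within k′) (size-after-single {S = S} St bound)
...       | no Mtt≢1 =
  pivot-step k′ (pivotPair₂ s≢t sym-M (Boolₚ.¬-not Mss≢1) (Boolₚ.¬-not Mtt≢1) Mst) ns (pivotPair-within k′)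
    (size-after-pair s≢t Ss St bound)
  where
  s≢t : s ≢ t
  s≢t refl = Mss≢1 Mst

pivotPair : ∀ {n} {M : Matrix n} {S : Vector n} → Symmetric M → NonSingular M S → PivotPair M S
pivotPair {S = S} = pivotPair-within (size S) ≤-refl

single-support : ∀ {n} {x : Vector n} {u : Fin n} → x ⊑ single u → ∀ j → j ≢ u → x j ≡ false
single-support x⊑u j j≢u = ⊑-outside x⊑u (δ-≢ j≢u)

single-nonsingular : ∀ {n} {R : Matrix n} {u : Fin n} → R u u ≡ true → NonSingular R (single u)
single-nonsingular {R = R} {u} Ruu x x⊑u kernel j with j ≟ u
... | no j≢u = single-support x⊑u j j≢u
... | yes refl = begin
  x j                  ≡⟨ cong (_∧ x j) Ruu ⟨
  R j j ∧ x j          ≡⟨ sum-point j (λ k k≢j → trans (cong (R j k ∧_) (single-support x⊑u k k≢j))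
                                                   (Boolₚ.∧-zeroʳ (R j k))) ⟨
  (R · x) j            ≡⟨ kernel j (δ-refl j) ⟩
  false                ∎

det₂ : Bool → Bool → Bool → Bool
det₂ a b c = (a ∧ c) xor b

kernel₂-trivial : ∀ {a b c} x y → det₂ a b c ≡ true →
  (a ∧ x) xor (b ∧ y) ≡ false → (b ∧ x) xor (c ∧ y) ≡ false → x ∨ y ≡ false
kernel₂-trivial {a} {b} {c} x y det e₁ e₂ = trans (sym (fill det e₁ e₂)) (fact a b c x y)
  where
  fact : ∀ a b c x y → det₂ a b c ∧ (not ((a ∧ x) xor (b ∧ y)) ∧ (not ((b ∧ x) xor (c ∧ y)) ∧ (x ∨ y))) ≡ false
  fact = boolean-identity 5
  fill : ∀ {d u v z} → d ≡ true → u ≡ false → v ≡ false → d ∧ (not u ∧ (not v ∧ z)) ≡ z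
  fill refl refl refl = refl

kernel₂-witness : ∀ {a b c} → det₂ a b c ≡ false →
  ((a ∧ (not a ∨ b)) xor (b ∧ a) ≡ false) × ((b ∧ (not a ∨ b)) xor (c ∧ a) ≡ false)
kernel₂-witness {a} {b} {c} det = trans (sym (fill det)) (first a b c) , trans (sym (fill det)) (second a b c)
  where
  first : ∀ a b c → not (det₂ a b c) ∧ ((a ∧ (not a ∨ b)) xor (b ∧ a)) ≡ false
  first = boolean-identity 3
  second : ∀ a b c → not (det₂ a b c) ∧ ((b ∧ (not a ∨ b)) xor (c ∧ a)) ≡ false
  second = boolean-identity 3
  fill : ∀ {d z} → d ≡ false → not d ∧ z ≡ z
  fill refl = refl

kernel₂-witness-nonzero : ∀ a b → (not a ∨ b) ∨ a ≡ true
kernel₂-witness-nonzero = boolean-identity 2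

-- The equations (R x)_s = x_t, (R x)_t = x_s on a 2×2 block are the kernel equations of
-- the block with its off-diagonal entry b replaced by not b, whose determinant is flipped.
shifted₁ : ∀ a b c d → ((a ∧ c) xor (b ∧ d) ≡ d) ⇔ ((a ∧ c) xor (not b ∧ d) ≡ false)
shifted₁ a b c d = mk⇔ (λ h → trans (regroup a b c d) (xor-≡-false h)) (λ h → ≡-from-xor (trans (sym (regroup a b c d)) h))
  where
  regroup : ∀ a b c d → (a ∧ c) xor (not b ∧ d) ≡ ((a ∧ c) xor (b ∧ d)) xor d
  regroup = boolean-identity 4

shifted₂ : ∀ b e c d → ((b ∧ c) xor (e ∧ d) ≡ c) ⇔ ((not b ∧ c) xor (e ∧ d) ≡ false)
shifted₂ b e c d = mk⇔ (λ h → trans (regroup b e c d) (xor-≡-false h)) (λ h → ≡-from-xor (trans (sym (regroup b e c d)) h))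
  where
  regroup : ∀ b e c d → (not b ∧ c) xor (e ∧ d) ≡ ((b ∧ c) xor (e ∧ d)) xor c
  regroup = boolean-identity 4

det₂-flip : ∀ a b c → det₂ a (not b) c ≡ not (det₂ a b c)
det₂-flip = boolean-identity 3

module _ {n} {s t : Fin n} (s≢t : s ≢ t) where

  pairVector : Bool → Bool → Vector n
  pairVector c d j = (δ j s ∧ c) xor (δ j t ∧ d)

  pairVector-s : ∀ c d → pairVector c d s ≡ c
  pairVector-s c d rewrite δ-refl s | δ-≢ s≢t = xor-identityʳ c

  pairVector-t : ∀ c d → pairVector c d t ≡ d
  pairVector-t c d rewrite δ-refl t | δ-≢ (λ t≡s → s≢t (sym t≡s)) = refl

  pairVector-elsewhere : ∀ c d {j} → j ≢ s → j ≢ t → pairVector c d j ≡ false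
  pairVector-elsewhere c d j≢s j≢t rewrite δ-≢ j≢s | δ-≢ j≢t = refl

  pairVector⊑pair : ∀ c d → pairVector c d ⊑ (single s ⊕ single t)
  pairVector⊑pair c d j xj with position s≢t j
  ... | at-s refl = pair-s s≢t
  ... | at-t refl = pair-t s≢t
  ... | elsewhere j≢s j≢t = contradiction (trans (sym xj) (pairVector-elsewhere c d j≢s j≢t)) λ ()

  pair-support : ∀ {x : Vector n} → x ⊑ (single s ⊕ single t) → ∀ j → j ≢ s → j ≢ t → x j ≡ false
  pair-support x⊑pair j j≢s j≢t = ⊑-outside x⊑pair (pair-elsewhere s≢t j≢s j≢t)

  zero-off-pair : ∀ {x : Vector n} → (∀ j → j ≢ s → j ≢ t → x j ≡ false) →
    x s ≡ false → x t ≡ false → IsZero x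
  zero-off-pair off xs xt j with position s≢t j
  ... | at-s refl = xs
  ... | at-t refl = xt
  ... | elsewhere j≢s j≢t = off j j≢s j≢t

  ·-off-pair : ∀ (M : Matrix n) {x : Vector n} → (∀ j → j ≢ s → j ≢ t → x j ≡ false) →
    ∀ i → (M · x) i ≡ (M i s ∧ x s) xor (M i t ∧ x t)
  ·-off-pair M {x} off i =
    sum-two-points s≢t (λ j j≢s j≢t → trans (cong (M i j ∧_) (off j j≢s j≢t)) (Boolₚ.∧-zeroʳ (M i j)))

  ·-pairVector : ∀ (M : Matrix n) c d i → (M · pairVector c d) i ≡ (M i s ∧ c) xor (M i t ∧ d)
  ·-pairVector M c d i = trans (·-off-pair M (λ j → pairVector-elsewhere c d) i)
    (cong₂ (λ u v → (M i s ∧ u) xor (M i t ∧ v)) (pairVector-s c d) (pairVector-t c d))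

  pair-nonsingular : ∀ {R : Matrix n} → Symmetric R → det₂ (R s s) (R s t) (R t t) ≡ true →
    NonSingular R (single s ⊕ single t)
  pair-nonsingular {R} sym-R det x x⊑pair kernel =
    zero-off-pair off (Boolₚ.∨-conicalˡ _ _ both) (Boolₚ.∨-conicalʳ _ _ both)
    where
    off = pair-support x⊑pair
    both : x s ∨ x t ≡ false
    both = kernel₂-trivial {R s s} {R s t} {R t t} (x s) (x t) det
      (trans (sym (·-off-pair R off s)) (kernel s (pair-s s≢t)))
      (trans (cong (λ r → (r ∧ x s) xor (R t t ∧ x t)) (sym-R s t))
        (trans (sym (·-off-pair R off t)) (kernel t (pair-t s≢t))))

  -- Conversely, a non-singular R[{s , t}] has determinant 1: otherwise the kernel
  -- witness of kernel₂-witness, placed at s and t, is a non-zero kernel vector.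
  pair-nonsingular⁻¹ : ∀ {R : Matrix n} → Symmetric R → NonSingular R (single s ⊕ single t) →
    det₂ (R s s) (R s t) (R t t) ≡ true
  pair-nonsingular⁻¹ {R} sym-R ns with det₂ (R s s) (R s t) (R t t) in det
  ... | true = refl
  ... | false = contradiction (trans (sym (kernel₂-witness-nonzero (R s s) (R s t))) witness≡0) λ ()
    where
    c = not (R s s) ∨ R s t
    d = R s s
    equations = kernel₂-witness {R s s} {R s t} {R t t} det
    in-kernel : ∀ i → (single s ⊕ single t) i ≡ true → (R · pairVector c d) i ≡ false
    in-kernel i pair-i with position s≢t i
    ... | at-s refl = trans (·-pairVector R c d i) (proj₁ equations)
    ... | at-t refl = trans (·-pairVector R c d i) (trans (cong (λ r → (r ∧ c) xor (R t t ∧ d)) (sym-R t s)) (proj₂ equations))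
    ... | elsewhere i≢s i≢t = contradiction (trans (sym pair-i) (pair-elsewhere s≢t i≢s i≢t)) λ ()
    w≡0 : IsZero (pairVector c d)
    w≡0 = ns (pairVector c d) (pairVector⊑pair c d) in-kernel
    witness≡0 : c ∨ d ≡ false
    witness≡0 = cong₂ _∨_ (trans (sym (pairVector-s c d)) (w≡0 s)) (trans (sym (pairVector-t c d)) (w≡0 t))

  toggle-s : ∀ {W : Vector n} → (W ⊕ (single s ⊕ single t)) s ≡ not (W s)
  toggle-s {W} = trans (cong (W s xor_) (pair-s s≢t)) (xor-comm (W s) true)

  toggle-t : ∀ {W : Vector n} → (W ⊕ (single s ⊕ single t)) t ≡ not (W t)
  toggle-t {W} = trans (cong (W t xor_) (pair-t s≢t)) (xor-comm (W t) true)

  toggle-elsewhere : ∀ {W : Vector n} {j} → j ≢ s → j ≢ t → (W ⊕ (single s ⊕ single t)) j ≡ W j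
  toggle-elsewhere {W} {j} j≢s j≢t = trans (cong (W j xor_) (pair-elsewhere s≢t j≢s j≢t)) (xor-identityʳ (W j))

addInto : ∀ {n} → Fin n → Fin n → Vector n → Vector n
addInto t s x j = x j xor (δ j t ∧ x s)

addInto-involutive : ∀ {n} {t s : Fin n} → t ≢ s → ∀ x → addInto t s (addInto t s x) ≗ x
addInto-involutive {t = t} {s} t≢s x j rewrite δ-≢ (λ s≡t → t≢s (sym s≡t)) = cancel (x j) (δ j t) (x s)
  where
  cancel : ∀ a d b → (a xor (d ∧ b)) xor (d ∧ (b xor (false ∧ b))) ≡ a
  cancel = boolean-identity 3

addInto-zero : ∀ {n} (t s : Fin n) {x : Vector n} → IsZero x → IsZero (addInto t s x)
addInto-zero t s {x} x≡0 j rewrite x≡0 j | x≡0 s = Boolₚ.∧-zeroʳ (δ j t)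

·-addInto : ∀ {n} (N : Matrix n) (t s : Fin n) (x : Vector n) i →
  (N · addInto t s x) i ≡ (N · x) i xor (N i t ∧ x s)
·-addInto N t s x i = begin
  sum (λ j → N i j ∧ (x j xor (δ j t ∧ x s)))               ≡⟨ sum-cong-≗ (λ j → spread (N i j) (x j) (δ j t) (x s)) ⟩
  sum (λ j → (N i j ∧ x j) xor (δ j t ∧ (N i j ∧ x s)))
    ≡⟨ sum-xor (λ j → N i j ∧ x j) (λ j → δ j t ∧ (N i j ∧ x s)) ⟩
  (N · x) i xor sum (λ j → δ j t ∧ (N i j ∧ x s))           ≡⟨ cong ((N · x) i xor_) (sum-δ t (λ j → N i j ∧ x s)) ⟩
  (N · x) i xor (N i t ∧ x s)                               ∎
  where
  spread : ∀ a b d c → a ∧ (b xor (d ∧ c)) ≡ (a ∧ b) xor (d ∧ (a ∧ c))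
  spread = boolean-identity 4

-- The matrix of the handle slide of α over β: E N Eᵀ, where E adds row β to row α.
slideMatrix : ∀ {n} → Matrix n → Fin n → Fin n → Matrix n
slideMatrix N α β i j =
  N i j xor ((δ i α ∧ N β j) xor ((δ j α ∧ N i β) xor ((δ i α ∧ δ j α) ∧ N β β)))

slide-action : ∀ {n} (N : Matrix n) (α β : Fin n) (x : Vector n) i →
  let y = N · addInto β α x in (slideMatrix N α β · x) i ≡ y i xor (δ i α ∧ y β)
slide-action N α β x i = begin
  (slideMatrix N α β · x) i
    ≡⟨ sum-cong-≗ (λ j → expand (N i j) (δ i α) (N β j) (δ j α) (N i β) (N β β) (x j)) ⟩
  sum (λ j → ((N i j ∧ x j) xor (δ i α ∧ (N β j ∧ x j))) xor (δ j α ∧ (c ∧ x j)))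
    ≡⟨ sum-xor (λ j → (N i j ∧ x j) xor (δ i α ∧ (N β j ∧ x j))) (λ j → δ j α ∧ (c ∧ x j)) ⟩
  sum (λ j → (N i j ∧ x j) xor (δ i α ∧ (N β j ∧ x j))) xor sum (λ j → δ j α ∧ (c ∧ x j))
    ≡⟨ cong₂ _xor_ (trans (sum-xor (λ j → N i j ∧ x j) (λ j → δ i α ∧ (N β j ∧ x j)))
                          (cong ((N · x) i xor_) (sum-scale (δ i α) (λ j → N β j ∧ x j))))
                   (sum-δ α (λ j → c ∧ x j)) ⟩
  ((N · x) i xor (δ i α ∧ (N · x) β)) xor (c ∧ x α)
    ≡⟨ regroup ((N · x) i) (δ i α) ((N · x) β) (N i β) (x α) (N β β) ⟩
  ((N · x) i xor (N i β ∧ x α)) xor (δ i α ∧ ((N · x) β xor (N β β ∧ x α)))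
    ≡⟨ sym (cong₂ (λ u v → u xor (δ i α ∧ v)) (·-addInto N β α x i) (·-addInto N β α x β)) ⟩
  (N · addInto β α x) i xor (δ i α ∧ (N · addInto β α x) β)
    ∎
  where
  c = N i β xor (δ i α ∧ N β β)
  expand : ∀ nij d nβj e niβ nββ x →
    (nij xor ((d ∧ nβj) xor ((e ∧ niβ) xor ((d ∧ e) ∧ nββ)))) ∧ x ≡
    ((nij ∧ x) xor (d ∧ (nβj ∧ x))) xor (e ∧ ((niβ xor (d ∧ nββ)) ∧ x))
  expand = boolean-identity 7
  regroup : ∀ yi d yβ niβ xα nββ →
    (yi xor (d ∧ yβ)) xor ((niβ xor (d ∧ nββ)) ∧ xα) ≡ (yi xor (niβ ∧ xα)) xor (d ∧ (yβ xor (nββ ∧ xα)))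
  regroup = boolean-identity 6

-- Sliding twice gives back N (over GF(2), E² = 1), and slides preserve symmetry.
slide-involutive : ∀ {n} (N : Matrix n) {α β : Fin n} → α ≢ β → slideMatrix (slideMatrix N α β) α β ≐ N
slide-involutive N {α} {β} α≢β i j rewrite δ-≢ (λ β≡α → α≢β (sym β≡α)) =
  cancel (N i j) (δ i α) (N β j) (δ j α) (N i β) (N β β)
  where
  cancel : ∀ nij d nβj e niβ nββ →
    (nij xor ((d ∧ nβj) xor ((e ∧ niβ) xor ((d ∧ e) ∧ nββ)))) xor
    ((d ∧ (nβj xor ((false ∧ nβj) xor ((e ∧ nββ) xor ((false ∧ e) ∧ nββ))))) xor
     ((e ∧ (niβ xor ((d ∧ nββ) xor ((false ∧ niβ) xor ((d ∧ false) ∧ nββ))))) xor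
      ((d ∧ e) ∧ (nββ xor ((false ∧ nββ) xor ((false ∧ nββ) xor ((false ∧ false) ∧ nββ))))))) ≡ nij
  cancel = boolean-identity 6

slide-symmetric : ∀ {n} {N : Matrix n} (α β : Fin n) → Symmetric N → Symmetric (slideMatrix N α β)
slide-symmetric {N = N} α β sym-N i j =
  trans (cong₂ (λ u v → u xor ((δ i α ∧ N β j) xor ((δ j α ∧ v) xor ((δ i α ∧ δ j α) ∧ N β β))))
               (sym-N i j) (sym-N i β))
  (trans (cong (λ u → N j i xor ((δ i α ∧ u) xor ((δ j α ∧ N β i) xor ((δ i α ∧ δ j α) ∧ N β β)))) (sym-N β j))
         (transpose (N j i) (δ i α) (N j β) (δ j α) (N β i) (N β β)))
  where
  transpose : ∀ a d b e c m →
    a xor ((d ∧ b) xor ((e ∧ c) xor ((d ∧ e) ∧ m))) ≡ a xor ((e ∧ c) xor ((d ∧ b) xor ((e ∧ d) ∧ m)))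
  transpose = boolean-identity 6

slide-outside : ∀ {n} {N : Matrix n} {α β : Fin n} {W : Vector n} → W α ≡ false →
  NonSingular N W ⇔ NonSingular (slideMatrix N α β) W
slide-outside {N = N} {α} {β} {W} Wα =
  mk⇔ (nonsingular-local agree) (nonsingular-local (λ x x⊑W i Wi → sym (agree x x⊑W i Wi)))
  where
  agree : ∀ x → x ⊑ W → ∀ i → W i ≡ true → (N · x) i ≡ (slideMatrix N α β · x) i
  agree x x⊑W i Wi = begin
    (N · x) i                                          ≡⟨ ·-cong N unchanged i ⟨
    (N · u) i                                          ≡⟨ xor-identityʳ ((N · u) i) ⟨
    (N · u) i xor false
      ≡⟨ cong (λ d → (N · u) i xor (d ∧ (N · u) β)) (δ-≢ (separated {W = W} Wi Wα)) ⟨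
    (N · u) i xor (δ i α ∧ (N · u) β)                  ≡⟨ slide-action N α β x i ⟨
    (slideMatrix N α β · x) i                          ∎
    where
    u = addInto β α x
    unchanged : u ≗ x
    unchanged j = trans (cong (λ v → x j xor (δ j β ∧ v)) (⊑-outside x⊑W Wα))
                        (trans (cong (x j xor_) (Boolₚ.∧-zeroʳ (δ j β))) (xor-identityʳ (x j)))

-- If α , β ∈ W, the slide is a change of basis of the principal submatrix on W.
slide-inside : ∀ {n} {N : Matrix n} {α β : Fin n} {W : Vector n} → α ≢ β → W α ≡ true → W β ≡ true →
  NonSingular N W → NonSingular (slideMatrix N α β) W
slide-inside {N = N} {α} {β} {W} α≢β Wα Wβ ns x x⊑W kernel j = begin
  x j                        ≡⟨ addInto-involutive β≢α x j ⟨
  addInto β α u j            ≡⟨ addInto-zero β α u≡0 j ⟩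
  false                      ∎
  where
  β≢α : β ≢ α
  β≢α β≡α = α≢β (sym β≡α)
  u = addInto β α x
  y = N · u
  slid : ∀ i → W i ≡ true → y i xor (δ i α ∧ y β) ≡ false
  slid i Wi = trans (sym (slide-action N α β x i)) (kernel i Wi)
  yβ : y β ≡ false
  yβ = trans (sym (trans (cong (λ d → y β xor (d ∧ y β)) (δ-≢ β≢α)) (xor-identityʳ (y β)))) (slid β Wβ)
  u-kernel : ∀ i → W i ≡ true → y i ≡ false
  u-kernel i Wi = trans (sym (trans (cong (λ v → y i xor (δ i α ∧ v)) yβ)
                           (trans (cong (y i xor_) (Boolₚ.∧-zeroʳ (δ i α))) (xor-identityʳ (y i))))) (slid i Wi)
  u⊑W : u ⊑ W
  u⊑W i ui with i ≟ β
  ... | yes refl = Wβ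
  ... | no _ = x⊑W i (trans (sym (xor-identityʳ (x i))) ui)
  u≡0 : IsZero u
  u≡0 = ns u u⊑W u-kernel

slide-inside⇔ : ∀ {n} {N : Matrix n} {α β : Fin n} {W : Vector n} → α ≢ β → W α ≡ true → W β ≡ true →
  NonSingular N W ⇔ NonSingular (slideMatrix N α β) W
slide-inside⇔ {N = N} α≢β Wα Wβ = mk⇔ (slide-inside α≢β Wα Wβ)
  (λ ns → nonsingular-local (λ x _ i _ → ·-cong-matrix (slide-involutive N α≢β) x i) (slide-inside α≢β Wα Wβ ns))

-- Sliding α ∈ W over β ∉ W when N[W] is non-singular: after pivoting N on W, the slide
-- is governed by the 2×2 block of R = N * W on {α , β}.
module SlideAcross {n} {N : Matrix n} {α β : Fin n} (α≢β : α ≢ β) {W : Vector n}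
                   (Wα : W α ≡ true) (Wβ : W β ≡ false) (P : PivotPair N W) where

  private
    R = pivoted P
    H = slideMatrix N α β
    sym-R = pivoted-symmetric P

  -- Determinant 0: a kernel vector x′ of the slid matrix on W gives, after undoing E and
  -- pivoting on W, a vector on {α , β} solving the flipped 2×2 system, hence zero.
  across-nonsingular : det₂ (R α α) (R α β) (R β β) ≡ false → NonSingular H W
  across-nonsingular det x′ x′⊑W kernel j =
    trans (sym (addInto-involutive β≢α x′ j)) (addInto-zero β α x≡0 j)
    where
    β≢α : β ≢ α
    β≢α β≡α = α≢β (sym β≡α)
    x = addInto β α x′
    y = N · x
    slid : ∀ i → W i ≡ true → y i xor (δ i α ∧ y β) ≡ false
    slid i Wi = trans (sym (slide-action N α β x′ i)) (kernel i Wi)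
    x̂ = select W y x
    xα : x α ≡ x′ α
    xα = trans (cong (λ e → x′ α xor (e ∧ x′ α)) (δ-≢ α≢β)) (xor-identityʳ (x′ α))
    xβ : x β ≡ x′ α
    xβ = trans (cong₂ (λ u e → u xor (e ∧ x′ α)) (⊑-outside x′⊑W Wβ) (δ-refl β)) refl
    yα≡yβ : y α ≡ y β
    yα≡yβ = ≡-from-xor (trans (cong (λ e → y α xor (e ∧ y β)) (sym (δ-refl α))) (slid α Wα))
    x̂α : x̂ α ≡ y α
    x̂α = cong (if_then y α else x α) Wα
    x̂β : x̂ β ≡ x′ α
    x̂β = trans (cong (if_then y β else x β) Wβ) xβ
    off : ∀ j → j ≢ α → j ≢ β → x̂ j ≡ false
    off j j≢α j≢β with W j in Wj
    ... | true = trans (sym (trans (cong (λ e → y j xor (e ∧ y β)) (δ-≢ j≢α)) (xor-identityʳ (y j)))) (slid j Wj)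
    ... | false = trans (cong (λ e → x′ j xor (e ∧ x′ α)) (δ-≢ j≢β))
                        (trans (xor-identityʳ (x′ j)) (⊑-outside x′⊑W Wj))
    eqα : (R α α ∧ x̂ α) xor (R α β ∧ x̂ β) ≡ x̂ β
    eqα = begin
      (R α α ∧ x̂ α) xor (R α β ∧ x̂ β)   ≡⟨ ·-off-pair α≢β R off α ⟨
      (R · x̂) α                          ≡⟨ forward P x α ⟩
      select W x y α                      ≡⟨ cong (if_then x α else y α) Wα ⟩
      x α                                 ≡⟨ trans xα (sym x̂β) ⟩
      x̂ β                                 ∎
    eqβ : (R α β ∧ x̂ α) xor (R β β ∧ x̂ β) ≡ x̂ α
    eqβ = begin
      (R α β ∧ x̂ α) xor (R β β ∧ x̂ β)   ≡⟨ cong (λ r → (r ∧ x̂ α) xor (R β β ∧ x̂ β)) (sym-R β α) ⟨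
      (R β α ∧ x̂ α) xor (R β β ∧ x̂ β)   ≡⟨ ·-off-pair α≢β R off β ⟨
      (R · x̂) β                          ≡⟨ forward P x β ⟩
      select W x y β                      ≡⟨ cong (if_then x β else y β) Wβ ⟩
      y β                                 ≡⟨ trans (sym yα≡yβ) (sym x̂α) ⟩
      x̂ α                                 ∎
    both : x̂ α ∨ x̂ β ≡ false
    both = kernel₂-trivial {R α α} {not (R α β)} {R β β} (x̂ α) (x̂ β)
      (trans (det₂-flip (R α α) (R α β) (R β β)) (cong not det))
      (Equivalence.to (shifted₁ (R α α) (R α β) (x̂ α) (x̂ β)) eqα)
      (Equivalence.to (shifted₂ (R α β) (R β β) (x̂ α) (x̂ β)) eqβ)
    x̂≡0 : IsZero x̂
    x̂≡0 = zero-off-pair α≢β off (Boolₚ.∨-conicalˡ _ _ both) (Boolₚ.∨-conicalʳ _ _ both)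
    x≡0 : IsZero x
    x≡0 i with W i in Wi
    ... | true = trans (sym (cong (if_then x i else y i) Wi)) (trans (sym (forward P x i)) (·-zero R x̂≡0 i))
    ... | false = trans (sym (cong (if_then y i else x i) Wi)) (x̂≡0 i)

  -- Determinant 1: a non-zero solution of the flipped 2×2 system, pivoted back to N and
  -- transformed by E, is a non-zero kernel vector of the slid matrix on W.
  across-singular : det₂ (R α α) (R α β) (R β β) ≡ true → ¬ NonSingular H W
  across-singular det ns = contradiction (trans (sym (kernel₂-witness-nonzero (R α α) (not (R α β)))) c∨d≡0) λ ()
    where
    β≢α : β ≢ α
    β≢α β≡α = α≢β (sym β≡α)
    c = not (R α α) ∨ not (R α β)
    d = R α α
    equations = kernel₂-witness {R α α} {not (R α β)} {R β β}
                  (trans (det₂-flip (R α α) (R α β) (R β β)) (cong not det))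
    x̂ = pairVector α≢β c d
    ŷ = R · x̂
    ŷα : ŷ α ≡ d
    ŷα = trans (·-pairVector α≢β R c d α) (Equivalence.from (shifted₁ (R α α) (R α β) c d) (proj₁ equations))
    ŷβ : ŷ β ≡ c
    ŷβ = trans (·-pairVector α≢β R c d β)
      (trans (cong (λ r → (r ∧ c) xor (R β β ∧ d)) (sym-R β α))
             (Equivalence.from (shifted₂ (R α β) (R β β) c d) (proj₂ equations)))
    x = select W ŷ x̂
    x′ = addInto β α x
    xα : x α ≡ d
    xα = trans (cong (if_then ŷ α else x̂ α) Wα) ŷα
    xβ : x β ≡ d
    xβ = trans (cong (if_then ŷ β else x̂ β) Wβ) (pairVector-t α≢β c d)
    x′β : x′ β ≡ false
    x′β = trans (cong₂ (λ u v → u xor v) xβ (trans (cong (_∧ x α) (δ-refl β)) xα)) (xor-same d)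
    x′-outside : ∀ j → W j ≡ false → x′ j ≡ false
    x′-outside j Wj = by-position (j ≟ β)
      where
      by-position : Dec (j ≡ β) → x′ j ≡ false
      by-position (yes j≡β) = subst (λ k → x′ k ≡ false) (sym j≡β) x′β
      by-position (no j≢β) = trans (cong (λ e → x j xor (e ∧ x α)) (δ-≢ j≢β))
        (trans (xor-identityʳ (x j))
        (trans (cong (if_then ŷ j else x̂ j) Wj) (pairVector-elsewhere α≢β c d (separated {W = W} Wα Wj ∘ sym) j≢β)))
    x′⊑W : x′ ⊑ W
    x′⊑W = ⊑-from-outside x′-outside
    Nx : ∀ i → (N · x) i ≡ select W x̂ ŷ i
    Nx = backward P x̂
    x′-kernel : ∀ i → W i ≡ true → (H · x′) i ≡ false
    x′-kernel i Wi = begin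
      (H · x′) i                                                      ≡⟨ slide-action N α β x′ i ⟩
      (N · addInto β α x′) i xor (δ i α ∧ (N · addInto β α x′) β)    ≡⟨ cong₂ (λ u v → u xor (δ i α ∧ v))
                                                                            (·-cong N (addInto-involutive β≢α x) i)
                                                                            (·-cong N (addInto-involutive β≢α x) β) ⟩
      (N · x) i xor (δ i α ∧ (N · x) β)                               ≡⟨ cong₂ (λ u v → u xor (δ i α ∧ v))
                                                                            (trans (Nx i) (cong (if_then x̂ i else ŷ i) Wi))
                                                                            (trans (Nx β) (trans (cong (if_then x̂ β else ŷ β) Wβ) ŷβ)) ⟩
      x̂ i xor (δ i α ∧ c)                                             ≡⟨ cancels ⟩
      false                                                           ∎
      where
      at-α : x̂ α xor (δ α α ∧ c) ≡ false
      at-α = trans (cong₂ (λ u e → u xor (e ∧ c)) (pairVector-s α≢β c d) (δ-refl α)) (xor-same c)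
      by-position : Dec (i ≡ α) → x̂ i xor (δ i α ∧ c) ≡ false
      by-position (yes i≡α) = subst (λ k → x̂ k xor (δ k α ∧ c) ≡ false) (sym i≡α) at-α
      by-position (no i≢α) = trans (cong (λ e → x̂ i xor (e ∧ c)) (δ-≢ i≢α))
        (trans (xor-identityʳ (x̂ i)) (pairVector-elsewhere α≢β c d i≢α (separated {W = W} Wi Wβ)))
      cancels : x̂ i xor (δ i α ∧ c) ≡ false
      cancels = by-position (i ≟ α)
    x≡0 : IsZero x
    x≡0 j = trans (sym (addInto-involutive β≢α x j)) (addInto-zero β α (ns x′ x′⊑W x′-kernel) j)
    c∨d≡0 : c ∨ d ≡ false
    c∨d≡0 = cong₂ _∨_
      (trans (sym (pairVector-s α≢β c d)) (trans (sym (cong (if_then x̂ α else ŷ α) Wα))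
                                                   (trans (sym (Nx α)) (·-zero N x≡0 α))))
      (trans (sym xβ) (x≡0 β))

slide-across : ∀ {n} {N : Matrix n} {α β : Fin n} {W : Vector n} → Symmetric N → α ≢ β →
  W α ≡ true → W β ≡ false → NonSingular N W →
  NonSingular (slideMatrix N α β) W ⇔ (¬ NonSingular N (W ⊕ (single α ⊕ single β)))
slide-across {N = N} {α} {β} sym-N α≢β Wα Wβ ns = mk⇔ to from
  where
  P = pivotPair sym-N ns
  R = pivoted P
  open SlideAcross α≢β Wα Wβ P
  to : NonSingular (slideMatrix N α β) _ → ¬ NonSingular N _
  to nsH nsW′ = across-singular
    (pair-nonsingular⁻¹ α≢β (pivoted-symmetric P) (Equivalence.to (pivot-twist P) nsW′)) nsH
  from : ¬ NonSingular N _ → NonSingular (slideMatrix N α β) _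
  from ¬ns with det₂ (R α α) (R α β) (R β β) in det
  ... | true = contradiction (Equivalence.from (pivot-twist P) (pair-nonsingular α≢β (pivoted-symmetric P) det)) ¬ns
  ... | false = across-nonsingular det

-- For α ∈ W and β ∉ W, sliding α over β on W amounts to sliding β over α on W △ {α , β}:
-- the vector x ↦ x with its α-coordinate moved to β carries one kernel onto the other.
slide-swap : ∀ {n} {N : Matrix n} {α β : Fin n} {W : Vector n} → α ≢ β → W α ≡ true → W β ≡ false →
  NonSingular (slideMatrix N β α) (W ⊕ (single α ⊕ single β)) → NonSingular (slideMatrix N α β) W
slide-swap {N = N} {α} {β} {W} α≢β Wα Wβ ns x′ x′⊑W kernel j =
  trans (sym (addInto-involutive β≢α x′ j)) (addInto-zero β α x≡0 j)
  where
  β≢α : β ≢ α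
  β≢α β≡α = α≢β (sym β≡α)
  W′ = W ⊕ (single α ⊕ single β)
  x = addInto β α x′
  y = N · x
  slid : ∀ i → W i ≡ true → y i xor (δ i α ∧ y β) ≡ false
  slid i Wi = trans (sym (slide-action N α β x′ i)) (kernel i Wi)
  yα≡yβ : y α ≡ y β
  yα≡yβ = ≡-from-xor (trans (cong (λ e → y α xor (e ∧ y β)) (sym (δ-refl α))) (slid α Wα))
  xα : x α ≡ x′ α
  xα = trans (cong (λ e → x′ α xor (e ∧ x′ α)) (δ-≢ α≢β)) (xor-identityʳ (x′ α))
  xβ : x β ≡ x′ α
  xβ = cong₂ (λ u e → u xor (e ∧ x′ α)) (⊑-outside x′⊑W Wβ) (δ-refl β)
  z = addInto α β x
  z-outside : ∀ j → W′ j ≡ false → z j ≡ false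
  z-outside j W′j with position α≢β j
  ... | at-s refl = trans (cong₂ (λ u e → u xor (e ∧ x β)) xα (δ-refl α)) (trans (cong (x′ α xor_) xβ) (xor-same (x′ α)))
  ... | at-t refl = contradiction (trans (sym W′j) (trans (toggle-t α≢β {W = W}) (cong not Wβ))) λ ()
  ... | elsewhere j≢α j≢β = begin
    x j xor (δ j α ∧ x β)        ≡⟨ cong (λ e → x j xor (e ∧ x β)) (δ-≢ j≢α) ⟩
    x j xor false                ≡⟨ xor-identityʳ (x j) ⟩
    x′ j xor (δ j β ∧ x′ α)      ≡⟨ cong (λ e → x′ j xor (e ∧ x′ α)) (δ-≢ j≢β) ⟩
    x′ j xor false               ≡⟨ xor-identityʳ (x′ j) ⟩
    x′ j                         ≡⟨ ⊑-outside x′⊑W (trans (sym (toggle-elsewhere α≢β {W = W} j≢α j≢β)) W′j) ⟩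
    false                        ∎
  z-kernel : ∀ i → W′ i ≡ true → (slideMatrix N β α · z) i ≡ false
  z-kernel i W′i = begin
    (slideMatrix N β α · z) i                                         ≡⟨ slide-action N β α z i ⟩
    (N · addInto α β z) i xor (δ i β ∧ (N · addInto α β z) α)         ≡⟨ cong₂ (λ u v → u xor (δ i β ∧ v))
                                                                          (·-cong N (addInto-involutive α≢β x) i)
                                                                          (·-cong N (addInto-involutive α≢β x) α) ⟩
    y i xor (δ i β ∧ y α)                                             ≡⟨ vanishes (position α≢β i) ⟩
    false                                                             ∎
    where
    vanishes : Position α≢β i → y i xor (δ i β ∧ y α) ≡ false
    vanishes (at-s refl) = contradiction (trans (sym W′i) (trans (toggle-s α≢β {W = W}) (cong not Wα))) λ ()
    vanishes (at-t refl) = trans (cong (λ e → y β xor (e ∧ y α)) (δ-refl β)) (xor-≡-false (sym yα≡yβ))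
    vanishes (elsewhere i≢α i≢β) = begin
      y i xor (δ i β ∧ y α)      ≡⟨ cong (λ e → y i xor (e ∧ y α)) (δ-≢ i≢β) ⟩
      y i xor false              ≡⟨ cong (λ e → y i xor (e ∧ y β)) (δ-≢ i≢α) ⟨
      y i xor (δ i α ∧ y β)      ≡⟨ slid i (trans (sym (toggle-elsewhere α≢β {W = W} i≢α i≢β)) W′i) ⟩
      false                      ∎
  x≡0 : IsZero x
  x≡0 j = trans (sym (addInto-involutive α≢β x j)) (addInto-zero α β (ns z (⊑-from-outside z-outside) z-kernel) j)

slide-exactly-one : ∀ {n} {N : Matrix n} {α β : Fin n} {W : Vector n} → Symmetric N → α ≢ β →
  W α ≡ true → W β ≡ false → ∀ {f f′} →
  (f ≡ true ⇔ NonSingular N W) → (f′ ≡ true ⇔ NonSingular N (W ⊕ (single α ⊕ single β))) →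
  (f xor f′ ≡ true) ⇔ NonSingular (slideMatrix N α β) W
slide-exactly-one {N = N} {α} {β} {W} sym-N α≢β Wα Wβ {true} {true} on-W on-W′ =
  mk⇔ (λ ()) (λ nsH → ⊥-elim (Equivalence.to (slide-across {N = N} sym-N α≢β Wα Wβ (Equivalence.to on-W refl)) nsH
                                             (Equivalence.to on-W′ refl)))
slide-exactly-one {N = N} {α} {β} {W} sym-N α≢β Wα Wβ {true} {false} on-W on-W′ =
  mk⇔ (λ _ → Equivalence.from (slide-across {N = N} sym-N α≢β Wα Wβ (Equivalence.to on-W refl))
                              (λ nsW′ → contradiction (Equivalence.from on-W′ nsW′) λ ()))
      (λ _ → refl)
slide-exactly-one {N = N} {α} {β} {W} sym-N α≢β Wα Wβ {false} {true} on-W on-W′ =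
  mk⇔ (λ _ → slide-swap {N = N} α≢β Wα Wβ
                (Equivalence.from (slide-across {N = N} sym-N (λ β≡α → α≢β (sym β≡α)) W′β W′α
                                                (Equivalence.to on-W′ refl))
                                  (λ nsW → contradiction (Equivalence.from on-W (nonsingular-cong back nsW)) λ ())))
      (λ _ → refl)
  where
  W′ = W ⊕ (single α ⊕ single β)
  W′α : W′ α ≡ false
  W′α = trans (toggle-s α≢β {W = W}) (cong not Wα)
  W′β : W′ β ≡ true
  W′β = trans (toggle-t α≢β {W = W}) (cong not Wβ)
  back : W′ ⊕ (single β ⊕ single α) ≗ W
  back i = cancel (W i) (δ i α) (δ i β)
    where
    cancel : ∀ w a b → (w xor (a xor b)) xor (b xor a) ≡ w
    cancel = boolean-identity 3
slide-exactly-one {N = N} {α} {β} {W} sym-N α≢β Wα Wβ {false} {false} on-W on-W′ =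
  mk⇔ (λ ()) (λ nsH → contradiction (Equivalence.from on-W (unslide (slid-twice nsH))) λ ())
  where
  H = slideMatrix N α β
  W′ = W ⊕ (single α ⊕ single β)
  W′α : W′ α ≡ false
  W′α = trans (toggle-s α≢β {W = W}) (cong not Wα)
  slid-twice : NonSingular H W → NonSingular (slideMatrix H α β) W
  slid-twice nsH = Equivalence.from (slide-across {N = H} (slide-symmetric α β sym-N) α≢β Wα Wβ nsH)
    (λ nsHW′ → contradiction (Equivalence.from on-W′ (Equivalence.from (slide-outside {N = N} W′α) nsHW′)) λ ())
  unslide : NonSingular (slideMatrix H α β) W → NonSingular N W
  unslide = nonsingular-local (λ x _ i _ → ·-cong-matrix (slide-involutive N α≢β) x i)

lookup-⊥ : ∀ {n} (i : Fin n) → lookup (⊥ {n}) i ≡ false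
lookup-⊥ i = lookup-replicate i false

lookup-△ : ∀ {n} (X Y : Subset n) i → lookup (X △ Y) i ≡ lookup X i xor lookup Y i
lookup-△ X Y i = lookup-zipWith _xor_ i X Y

lookup-∪ : ∀ {n} (X Y : Subset n) i → lookup (X ∪ Y) i ≡ lookup X i ∨ lookup Y i
lookup-∪ X Y i = lookup-zipWith _∨_ i X Y

lookup-⁅⁆ : ∀ {n} (u i : Fin n) → lookup ⁅ u ⁆ i ≡ δ i u
lookup-⁅⁆ u i with i ≟ u
... | yes refl = []=⇒lookup (x∈⁅x⁆ i)
... | no i≢u = Boolₚ.¬-not (λ ui → i≢u (x∈⁅y⁆⇒x≡y u (lookup⇒[]= i ⁅ u ⁆ ui)))

subset-ext : ∀ {n} {X Y : Subset n} → lookup X ≗ lookup Y → X ≡ Y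
subset-ext {X = X} {Y} X≗Y = trans (sym (tabulate∘lookup X)) (trans (tabulate-cong X≗Y) (tabulate∘lookup Y))

nonSingularPrincipal⇔ : ∀ {n} (M : Matrix n) (A : Subset n) → NonSingularPrincipal M A ⇔ NonSingular M (lookup A)
nonSingularPrincipal⇔ M A = mk⇔ to from
  where
  to : NonSingularPrincipal M A → NonSingular M (lookup A)
  to ns x x⊑A kernel i = begin
    x i                    ≡⟨ lookup∘tabulate x i ⟨
    lookup (tabulate x) i  ≡⟨ cong (λ v → lookup v i) xv≡⊥ ⟩
    lookup ⊥ i             ≡⟨ lookup-⊥ i ⟩
    false                  ∎
    where
    xv≡⊥ = ns (tabulate x)
      (λ {j} j∈x → lookup⇒[]= j A (x⊑A j (trans (sym (lookup∘tabulate x j)) ([]=⇒lookup j∈x))))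
      (λ j j∈A → trans (Σ₂≡sum (λ k → M j k ∧ lookup (tabulate x) k))
                 (trans (sum-cong-≗ (λ k → cong (M j k ∧_) (lookup∘tabulate x k)))
                                          (kernel j ([]=⇒lookup j∈A))))
  from : NonSingular M (lookup A) → NonSingularPrincipal M A
  from ns xv xv⊆A kernel = subset-ext (λ i → trans (xv≡0 i) (sym (lookup-⊥ i)))
    where
    xv≡0 = ns (lookup xv) (λ j xj → []=⇒lookup (xv⊆A (lookup⇒[]= j xv xj)))
                          (λ j Aj → trans (sym (Σ₂≡sum (λ k → M j k ∧ lookup xv k))) (kernel j (lookup⇒[]= j A Aj)))

relabel : ∀ {n} → Permutation′ n → Matrix n → Matrix n
relabel π M i j = M (π ⟨$⟩ʳ i) (π ⟨$⟩ʳ j)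

relabel-· : ∀ {n} (π : Permutation′ n) (M : Matrix n) (x : Vector n) i →
  (M · (x ∘ (π ⟨$⟩ˡ_))) (π ⟨$⟩ʳ i) ≡ (relabel π M · x) i
relabel-· π M x i = begin
  sum (λ k → M (π ⟨$⟩ʳ i) k ∧ x (π ⟨$⟩ˡ k))
    ≡⟨ sum-permute (λ k → M (π ⟨$⟩ʳ i) k ∧ x (π ⟨$⟩ˡ k)) π ⟩
  sum (λ l → M (π ⟨$⟩ʳ i) (π ⟨$⟩ʳ l) ∧ x (π ⟨$⟩ˡ (π ⟨$⟩ʳ l)))
    ≡⟨ sum-cong-≗ (λ l → cong (λ k → M (π ⟨$⟩ʳ i) (π ⟨$⟩ʳ l) ∧ x k) (inverseˡ π)) ⟩
  (relabel π M · x) i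
    ∎

relabel-nonsingular : ∀ {n} (π : Permutation′ n) {M : Matrix n} {A : Vector n} →
  NonSingular M A → NonSingular (relabel π M) (A ∘ (π ⟨$⟩ʳ_))
relabel-nonsingular π {M} {A} ns x x⊑A kernel i = begin
  x i                          ≡⟨ cong x (inverseˡ π) ⟨
  x (π ⟨$⟩ˡ (π ⟨$⟩ʳ i))        ≡⟨ x′≡0 (π ⟨$⟩ʳ i) ⟩
  false                        ∎
  where
  x′ = x ∘ (π ⟨$⟩ˡ_)
  x′≡0 : IsZero x′
  x′≡0 = ns x′ (λ k x′k → subst (λ l → A l ≡ true) (inverseʳ π) (x⊑A (π ⟨$⟩ˡ k) x′k))
    (λ k Ak → begin
      (M · x′) k                          ≡⟨ cong (M · x′) (inverseʳ π) ⟨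
      (M · x′) (π ⟨$⟩ʳ (π ⟨$⟩ˡ k))        ≡⟨ relabel-· π M x (π ⟨$⟩ˡ k) ⟩
      (relabel π M · x) (π ⟨$⟩ˡ k)        ≡⟨ kernel (π ⟨$⟩ˡ k) (trans (cong A (inverseʳ π)) Ak) ⟩
      false                               ∎)

relabel⇔ : ∀ {n} (π : Permutation′ n) {M : Matrix n} {A : Vector n} →
  NonSingular M A ⇔ NonSingular (relabel π M) (A ∘ (π ⟨$⟩ʳ_))
relabel⇔ π {M} {A} = mk⇔ (relabel-nonsingular π)
  (λ ns → nonsingular-cong (λ i → cong A (inverseʳ π {i}))
    (nonsingular-local (λ x _ i _ → ·-cong-matrix (λ k l → cong₂ M (inverseʳ π {k}) (inverseʳ π {l})) x i)
      (relabel-nonsingular (flip π) ns)))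

Represents : ∀ {n} → Matrix n → SetSystem n → Set
Represents M F = ∀ X → Feasible F X ⇔ NonSingular M (lookup X)

feasible-cong : ∀ {n} (F : SetSystem n) {X Y : Subset n} → X ≡ Y → Feasible F X ⇔ Feasible F Y
feasible-cong F refl = ⇔.refl

△-cancel : ∀ {n} (A Z : Subset n) → A △ (A △ Z) ≡ Z
△-cancel A Z = subset-ext (λ i → trans (lookup-△ A (A △ Z) i)
  (trans (cong (lookup A i xor_) (lookup-△ A Z i)) (xor-cancelˡ (lookup A i) (lookup Z i))))

-- A binary set system with ∅ feasible is D(R) for a symmetric R, with no twist and no
-- relabelling: relabel the matrix along σ, then pivot on the twisting set A, which is
-- feasible in the twist because ∅ is feasible in F.
binary-represented : ∀ {n} {F : SetSystem n} → IsBinary F → Feasible F ⊥ →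
  Σ (Matrix n) λ R → Symmetric R × Represents R F
binary-represented {n} {F} (A , M , σ , sym-M , iso) F⊥ =
  pivoted P , pivoted-symmetric P , λ Z → ⇔.trans (twisted Z) (pivot-twist P)
  where
  M′ = relabel σ M
  S = lookup A
  untwisted : ∀ X → Feasible F (A △ X) ⇔ NonSingular M′ (lookup X)
  untwisted X =
    ⇔.trans (mk⇔ (proj₁ (iso X)) (proj₂ (iso X)))
    (⇔.trans (nonSingularPrincipal⇔ M (image σ X))
    (⇔.trans (nonsingular-cong⇔ (lookup∘tabulate (λ i → lookup X (σ ⟨$⟩ˡ i))))
    (⇔.trans (relabel⇔ σ) (nonsingular-cong⇔ (λ i → cong (lookup X) (inverseˡ σ))))))
  twisted : ∀ Z → Feasible F Z ⇔ NonSingular M′ (S ⊕ lookup Z)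
  twisted Z =
    ⇔.trans (feasible-cong F (sym (△-cancel A Z)))
    (⇔.trans (untwisted (A △ Z)) (nonsingular-cong⇔ (lookup-△ A Z)))
  P = pivotPair {M = M′} (λ i j → sym-M (σ ⟨$⟩ʳ i) (σ ⟨$⟩ʳ j))
        (nonsingular-cong (λ i → trans (cong (S i xor_) (lookup-⊥ i)) (xor-identityʳ (S i)))
          (Equivalence.to (twisted ⊥) F⊥))

represented-empty : ∀ {n} {R : Matrix n} {F : SetSystem n} → Represents R F → Feasible F ⊥
represented-empty rep = Equivalence.from (rep ⊥) (λ x x⊑⊥ _ i → ⊑-outside x⊑⊥ (lookup-⊥ i))

represented-binary : ∀ {n} {R : Matrix n} {F : SetSystem n} → Symmetric R → Represents R F → IsBinary F
represented-binary {R = R} {F} sym-R rep = ⊥ , R , identityPermutation , sym-R , λ X →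
  let equivalent = ⇔.trans (feasible-cong F (subset-ext (λ i → trans (lookup-△ ⊥ X i) (cong (_xor lookup X i) (lookup-⊥ i)))))
                   (⇔.trans (rep X) (⇔.trans (nonsingular-cong⇔ (λ i → sym (lookup∘tabulate (lookup X) i)))
                                            (⇔.sym (nonSingularPrincipal⇔ R (image identityPermutation X)))))
  in Equivalence.to equivalent , Equivalence.from equivalent

lookup-moved : ∀ {n} (Z : Subset n) {a b : Fin n} → a ≢ b → lookup Z a ≡ true → lookup Z b ≡ false →
  lookup ((Z [ a ]≔ false) [ b ]≔ true) ≗ lookup Z ⊕ (single a ⊕ single b)
lookup-moved Z {a} {b} a≢b Za Zb i with position a≢b i
... | at-s refl = trans (lookup∘update′ a≢b (Z [ a ]≔ false) true)
                        (trans (lookup∘update a Z false) (sym (trans (toggle-s a≢b {W = lookup Z}) (cong not Za))))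
... | at-t refl = trans (lookup∘update b (Z [ a ]≔ false) true) (sym (trans (toggle-t a≢b {W = lookup Z}) (cong not Zb)))
... | elsewhere i≢a i≢b = trans (lookup∘update′ i≢b (Z [ a ]≔ false) true)
                                (trans (lookup∘update′ i≢a Z false) (sym (toggle-elsewhere a≢b {W = lookup Z} i≢a i≢b)))

private
  xor-false⇔ : ∀ {p : Bool} → (p xor false ≡ true) ⇔ (p ≡ true)
  xor-false⇔ {p} = mk⇔ (trans (sym (xor-identityʳ p))) (trans (xor-identityʳ p))

slide-represents : ∀ {n} {N : Matrix n} {F : SetSystem n} {a b : Fin n} → Symmetric N → a ≢ b →
  Represents N F → Represents (slideMatrix N a b) (handleSlide F a b)
slide-represents {N = N} {F} {a} {b} sym-N a≢b rep Z with lookup Z a in Za | lookup Z b in Zb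
... | false | _ = ⇔.trans xor-false⇔ (⇔.trans (rep Z) (slide-outside Za))
... | true | true = ⇔.trans xor-false⇔ (⇔.trans (rep Z) (slide-inside⇔ a≢b Za Zb))
... | true | false = slide-exactly-one sym-N a≢b Za Zb (rep Z)
  (⇔.trans (rep ((Z [ a ]≔ false) [ b ]≔ true)) (nonsingular-cong⇔ (lookup-moved Z a≢b Za Zb)))

lookup-⁅⁆∪⁅⁆ : ∀ {n} {u w : Fin n} → u ≢ w → ∀ i → lookup (⁅ u ⁆ ∪ ⁅ w ⁆) i ≡ (single u ⊕ single w) i
lookup-⁅⁆∪⁅⁆ {u = u} {w} u≢w i =
  trans (lookup-∪ ⁅ u ⁆ ⁅ w ⁆ i) (trans (cong₂ _∨_ (lookup-⁅⁆ u i) (lookup-⁅⁆ w i)) (disjoint (position u≢w i)))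
  where
  disjoint : Position u≢w i → δ i u ∨ δ i w ≡ δ i u xor δ i w
  disjoint (at-s refl) = trans (cong (_∨ δ i w) (δ-refl i)) (sym (pair-s u≢w))
  disjoint (at-t refl) = trans (cong (δ i u ∨_) (δ-refl i)) (trans (Boolₚ.∨-zeroʳ (δ i u)) (sym (pair-t u≢w)))
  disjoint (elsewhere i≢u i≢w) = trans (cong₂ _∨_ (δ-≢ i≢u) (δ-≢ i≢w)) (sym (pair-elsewhere u≢w i≢u i≢w))

-- Given feasible
-- X, Y and u ∈ X △ Y, pivot on X: in R = N * X the set X △ Y is non-singular, and the
-- required v comes from a non-singular 1×1 or 2×2 principal submatrix of R at u.
represented-deltaMatroid : ∀ {n} {N : Matrix n} {F : SetSystem n} → Symmetric N → Represents N F →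
  IsDeltaMatroid F
represented-deltaMatroid {n} {N} {F} sym-N rep = (⊥ , represented-empty rep) , exchange
  where
  exchange : ∀ X Y → Feasible F X → Feasible F Y → ∀ u → u ∈ (X △ Y) →
    ∃ λ v → v ∈ (X △ Y) × Feasible F (X △ (⁅ u ⁆ ∪ ⁅ v ⁆))
  exchange X Y FX FY u u∈X△Y = step (R u u Boolₚ.≟ true)
    where
    P = pivotPair sym-N (Equivalence.to (rep X) FX)
    R = pivoted P
    D = lookup (X △ Y)
    nsD : NonSingular R D
    nsD = Equivalence.to (pivot-twist P)
      (nonsingular-cong (λ i → sym (trans (cong (lookup X i xor_) (lookup-△ X Y i)) (xor-cancelˡ (lookup X i) (lookup Y i))))
        (Equivalence.to (rep Y) FY))
    feasible-after : ∀ v {T} → NonSingular R T → lookup (⁅ u ⁆ ∪ ⁅ v ⁆) ≗ T →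
      Feasible F (X △ (⁅ u ⁆ ∪ ⁅ v ⁆))
    feasible-after v {T} nsT uv≗T = Equivalence.from (rep _)
      (nonsingular-cong (λ i → sym (trans (lookup-△ X _ i) (cong (lookup X i xor_) (uv≗T i))))
        (Equivalence.from (pivot-twist P) nsT))
    step : Dec (R u u ≡ true) → ∃ λ v → v ∈ (X △ Y) × Feasible F (X △ (⁅ u ⁆ ∪ ⁅ v ⁆))
    step (yes Ruu) = u , u∈X△Y , feasible-after u (single-nonsingular Ruu)
      (λ i → trans (lookup-∪ ⁅ u ⁆ ⁅ u ⁆ i) (trans (Boolₚ.∨-idem (lookup ⁅ u ⁆ i)) (lookup-⁅⁆ u i)))
    step (no Ruu≢1) with row-nonzero (pivoted-symmetric P) nsD ([]=⇒lookup u∈X△Y)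
    ... | w , Dw , Ruw = w , lookup⇒[]= w (X △ Y) Dw ,
      feasible-after w (pair-nonsingular u≢w (pivoted-symmetric P) det) (lookup-⁅⁆∪⁅⁆ u≢w)
      where
      u≢w : u ≢ w
      u≢w refl = Ruu≢1 Ruw
      det : det₂ (R u u) (R u w) (R w w) ≡ true
      det = trans (cong₂ (λ d r → (d ∧ R w w) xor r) (Boolₚ.¬-not Ruu≢1) Ruw) refl

corollary3p4 : ∀ {n} (F : SetSystem n) (a b : Fin n) →
    IsDeltaMatroid F → IsBinary F → Feasible F ⊥ → a ≢ b →
    IsDeltaMatroid (handleSlide F a b) × IsBinary (handleSlide F a b) ×
      Feasible (handleSlide F a b) ⊥
corollary3p4 F a b _ binary F⊥ a≢b with binary-represented binary F⊥
... | N , sym-N , represents-F =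
  represented-deltaMatroid {F = handleSlide F a b} sym-H represents-slide ,
  represented-binary {F = handleSlide F a b} sym-H represents-slide ,
  represented-empty {F = handleSlide F a b} represents-slide
  where
  sym-H = slide-symmetric a b sym-N
  represents-slide = slide-represents {N = N} {F} sym-N a≢b represents-F
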